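{- For all $n\ge1$, $Z(G_n)=Z(\widehat{G}_n)=t_n+1$, where $G_n$, $\widehat{G}_n$ and $t_n$ are as defined in the context.
   Context: Zero forcing: given a graph and a set $S$ of initially black vertices (all others white), repeatedly apply the rule: if a black vertex $v$ has exactly one white neighbor $u$, then $u$ becomes black (and stays black). $S$ is a zero forcing set if every vertex eventually becomes black. $Z(G)$ is the minimum size of a zero forcing set of $G$. Construction: for $d\ge1$, let $B_d$ be the complete binary tree on $2^d-1$ vertices with root $r$ ($B_1$ is a single vertex; for $d>1$ the root has two children which are roots of copies of $B_{d-1}$). A subdivided $K_4$ is the graph obtained from $K_4$ on vertices $a,b,c,e$ by subdividing the edge $ab$ with a new vertex $\ell$. For $n\ge1$, $G_n$ is obtained from $B_{2n-1}$ by attaching to every leaf $\ell$ of $B_{2n-1}$ a private copy of the subdivided $K_4$ in which $\ell$ plays the role of the subdividing vertex (i.e. add new vertices $a,b,c,e$ with edges $\ell a,\ell b,ac,ae,bc,be,ce$). Let $r_n$ denote the root of $B_{2n-1}$. The graph $\widehat{G}_n$ is obtained from $G_n$ by adding a new vertex $y_n$ adjacent only to $r_n$. The sequence $t_n$ is defined by $t_1=2$ and $t_{n+1}=4t_n+2$ for $n\ge1$. -}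

module Defs where

open import Data.Nat using (ℕ; zero; suc; _+_; _*_; _∸_; _^_; _≤_; _<_)
open import Data.Fin using (Fin; toℕ)
open import Data.Fin.Subset using (Subset; _∈_; _∉_; _∪_; ⁅_⁆; ⊤; ∣_∣)
open import Data.Product using (Σ; ∃; _×_; _,_)
open import Data.Sum using (_⊎_)
open import Relation.Nullary using (¬_)
open import Relation.Binary.PropositionalEquality using (_≡_; _≢_)
open import Relation.Binary.Construct.Closure.ReflexiveTransitive using (Star)

-- Simple graphs on vertex set Fin V (adjacency relation; all graphs
-- built below have symmetric, irreflexive adjacency by construction).

record Graph : Set₁ where
  field
    V   : ℕ
    Adj : Fin V → Fin V → Set
open Graph public

ForceStep : (G : Graph) → Subset (V G) → Subset (V G) → Set
ForceStep G B B' =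
  Σ (Fin (V G)) λ v → Σ (Fin (V G)) λ u →
    v ∈ B × u ∉ B × Adj G v u ×
    (∀ w → Adj G v w → w ≢ u → w ∈ B) ×
    B' ≡ B ∪ ⁅ u ⁆

IsZeroForcingSet : (G : Graph) → Subset (V G) → Set
IsZeroForcingSet G S = Star (ForceStep G) S ⊤

ZeroForcingNumber : Graph → ℕ → Set
ZeroForcingNumber G k =
  (Σ (Subset (V G)) λ S → IsZeroForcingSet G S × ∣ S ∣ ≡ k) ×
  (∀ S → IsZeroForcingSet G S → k ≤ ∣ S ∣)

-- B_d with d = 2n-1 uses heap numbering 0 .. T-1 (T = 2^d - 1), the
-- children of vertex x being 2x+1 and 2x+2; the root is 0 and the leaves
-- are L-1 .. T-1 where L = 2^(d-1).  The subdivided-K4 gadget of the j-th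
-- leaf (vertex L-1+j, j < L) has vertices a,b,c,e = T+4j, T+4j+1, T+4j+2,
-- T+4j+3.  G_n has T + 4L vertices; Ĝ_n has one more, y = T + 4L.

depth : ℕ → ℕ
depth n = 2 * n ∸ 1

treeSize : ℕ → ℕ
treeSize n = 2 ^ depth n ∸ 1

leafCount : ℕ → ℕ
leafCount n = 2 ^ (depth n ∸ 1)

data GEdge (n : ℕ) : ℕ → ℕ → Set where
  tree-left  : ∀ x → 2 * x + 2 < treeSize n → GEdge n x (2 * x + 1)
  tree-right : ∀ x → 2 * x + 2 < treeSize n → GEdge n x (2 * x + 2)
  leaf-a : ∀ j → j < leafCount n → GEdge n (leafCount n ∸ 1 + j) (treeSize n + 4 * j)
  leaf-b : ∀ j → j < leafCount n → GEdge n (leafCount n ∸ 1 + j) (treeSize n + 4 * j + 1)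
  a-c : ∀ j → j < leafCount n → GEdge n (treeSize n + 4 * j) (treeSize n + 4 * j + 2)
  a-e : ∀ j → j < leafCount n → GEdge n (treeSize n + 4 * j) (treeSize n + 4 * j + 3)
  b-c : ∀ j → j < leafCount n → GEdge n (treeSize n + 4 * j + 1) (treeSize n + 4 * j + 2)
  b-e : ∀ j → j < leafCount n → GEdge n (treeSize n + 4 * j + 1) (treeSize n + 4 * j + 3)
  c-e : ∀ j → j < leafCount n → GEdge n (treeSize n + 4 * j + 2) (treeSize n + 4 * j + 3)

data GHatEdge (n : ℕ) : ℕ → ℕ → Set where
  old    : ∀ {x y} → GEdge n x y → GHatEdge n x y
  root-y : GHatEdge n 0 (treeSize n + 4 * leafCount n)

G : ℕ → Graph
G n = record
  { V   = treeSize n + 4 * leafCount n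
  ; Adj = λ x y → GEdge n (toℕ x) (toℕ y) ⊎ GEdge n (toℕ y) (toℕ x)
  }

Ĝ : ℕ → Graph
Ĝ n = record
  { V   = suc (treeSize n + 4 * leafCount n)
  ; Adj = λ x y → GHatEdge n (toℕ x) (toℕ y) ⊎ GHatEdge n (toℕ y) (toℕ x)
  }

-- t_1 = 2, t_{n+1} = 4 t_n + 2  (value at 0 is an unused junk value).

t : ℕ → ℕ
t zero = 0
t (suc zero) = 2
t (suc (suc k)) = 4 * t (suc k) + 2

-- A set S of black vertices cannot be zero forcing if some fort (a nonempty set F of white vertices such
-- that no vertex outside F has exactly one neighbour in F) is white.  Each gadget contains the forts
-- {a, b} and {c, e}, and with its leaf ℓ the pendant forts {ℓ, p, q} (p ∈ {a, b}, q ∈ {c, e}), which are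
-- forts except at the parent of ℓ.  View G_n as nested blocks B_(2m+1): a vertex x together with the
-- blocks of its four grandchildren.  By induction on m, a block with at most t_(m+1) vertices of S
-- contains a white fort or a white pendant fort at its root, and a white fort if it has fewer.  Indeed,
-- pendant forts at two siblings form a fort, so the two grandchild blocks below a child of x yield a fort
-- or hold at least 2 t_(m+1) + 1 vertices of S, and more unless there is a pendant fort below that
-- child.  As t_(m+2) = 4 t_(m+1) + 2, a block with at most t_(m+2) vertices of S without a fort therefore
-- has pendant forts below both children and x white, and these form a pendant fort at x.  At the root a
-- pendant fort is a fort of G_n, and together with y_n one of Ĝ_n unless y_n ∈ S.
--
-- Conversely, the root, the vertices ll x and rl x of every block root x above the leaves, and a and c
-- of every gadget form a zero forcing set of size t_n + 1: top-down, the block of ll x is forced, then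
-- ll x forces left x, which forces lr x, and symmetrically on the right; in a gadget a forces e and c
-- forces b; in Ĝ_n the root finally forces y_n.
module Submission where

open import Defs
open import Data.Bool using (Bool; true; false)
open import Data.Empty using (⊥-elim)
open import Data.Fin using (Fin; toℕ; fromℕ<)
open import Data.Fin.Properties using (toℕ-injective; toℕ-fromℕ<; toℕ-fromℕ; toℕ<n)
open import Data.Fin.Subset using (Subset; _∈_; _∉_; _⊆_; _∪_; ⁅_⁆; ∣_∣)
  renaming (⊥ to ∅)
open import Data.Fin.Subset.Properties
  using (x∈p∪q⁻; x∈p∪q⁺; x∈⁅x⁆; x∈⁅y⁆⇒x≡y; ∈⊤; ⊆-antisym; ⊆⊤; _∈?_; ∣⁅x⁆∣≡1; ∣⊥∣≡0)
open import Data.Nat using (ℕ; zero; suc; _+_; _*_; _∸_; _^_; _≤_; _<_; z≤n; s≤s; s≤s⁻¹; _≟_; _<?_)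
open import Data.Nat.Properties
open import Data.Nat.Tactic.RingSolver using (solve-∀)
open import Data.Product using (Σ; _×_; _,_; proj₁; proj₂)
open import Data.Sum using (_⊎_; inj₁; inj₂)
open import Data.Vec using ([]; _∷_; here; there)
open import Relation.Binary.Construct.Closure.ReflexiveTransitive using (Star; ε; _◅_; _◅◅_)
open import Relation.Binary.PropositionalEquality
  using (_≡_; _≢_; refl; sym; trans; cong; cong₂; subst; subst₂; module ≡-Reasoning)
open import Relation.Nullary using (¬_; Dec; yes; no)
open import Relation.Nullary.Decidable using (_⊎-dec_)

module _ (Γ : Graph) where
  private
    Vertex = Fin (V Γ)

  IsFort : (Vertex → Set) → Set
  IsFort F = ∀ v u → ¬ F v → F u → Adj Γ v u → Σ Vertex λ w → w ≢ u × Adj Γ v w × F w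

  WhiteOn : (Vertex → Set) → Subset (V Γ) → Set
  WhiteOn F B = ∀ x → F x → x ∉ B

  force-preserves-white : ∀ {F B C} → IsFort F → ForceStep Γ B C → WhiteOn F B → WhiteOn F C
  force-preserves-white {F} {B} fort (v , u , v∈B , u∉B , vu , others , refl) white x Fx x∈C
    with x∈p∪q⁻ B ⁅ u ⁆ x∈C
  ... | inj₁ x∈B = white x Fx x∈B
  ... | inj₂ x∈⁅u⁆ with x∈⁅y⁆⇒x≡y u x∈⁅u⁆
  ... | refl with fort v x (λ Fv → white v Fv v∈B) Fx vu
  ... | w , w≢x , vw , Fw = white w Fw (others w vw w≢x)

  forcing-preserves-white : ∀ {F B C} → IsFort F → Star (ForceStep Γ) B C → WhiteOn F B → WhiteOn F C
  forcing-preserves-white fort ε = λ white → white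
  forcing-preserves-white fort (step ◅ steps) white =
    forcing-preserves-white fort steps (force-preserves-white fort step white)

  fort⇒¬zeroForcing : ∀ {F S} → IsFort F → WhiteOn F S → Σ Vertex F → ¬ IsZeroForcingSet Γ S
  fort⇒¬zeroForcing fort white (x , Fx) zfs = forcing-preserves-white fort zfs white x Fx ∈⊤

  Forced : Subset (V Γ) → (Vertex → Set) → Set
  Forced S P = Σ (Subset (V Γ)) λ C → Star (ForceStep Γ) S C × (∀ v → P v → v ∈ C)

  force-grows : ∀ {B C} → ForceStep Γ B C → B ⊆ C
  force-grows (_ , _ , _ , _ , _ , _ , refl) x∈B = x∈p∪q⁺ (inj₁ x∈B)

  forcing-grows : ∀ {B C} → Star (ForceStep Γ) B C → B ⊆ C
  forcing-grows ε x∈B = x∈B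
  forcing-grows (step ◅ steps) x∈B = forcing-grows steps (force-grows step x∈B)

  forced-initial : ∀ S → Forced S (_∈ S)
  forced-initial S = S , ε , λ _ v∈S → v∈S

  forced-mono : ∀ {S P Q} → Forced S P → (∀ v → Q v → P v) → Forced S Q
  forced-mono (C , steps , black) Q⊆P = C , steps , λ v Qv → black v (Q⊆P v Qv)

  forced-∪-initial : ∀ {S P} → Forced S P → Forced S (λ v → P v ⊎ v ∈ S)
  forced-∪-initial (C , steps , black) =
    C , steps , λ { v (inj₁ Pv) → black v Pv ; v (inj₂ v∈S) → forcing-grows steps v∈S }

  forced-force : ∀ {S P} → Forced S P → ∀ v u → P v → (∀ w → Adj Γ v w → w ≢ u → P w) →
                 Adj Γ v u → Forced S (λ x → P x ⊎ x ≡ u)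
  forced-force (C , steps , black) v u Pv others vu with u ∈? C
  ... | yes u∈C = C , steps , λ { x (inj₁ Px) → black x Px ; x (inj₂ refl) → u∈C }
  ... | no u∉C =
    C ∪ ⁅ u ⁆ , steps ◅◅ (step ◅ ε) ,
    λ { x (inj₁ Px) → x∈p∪q⁺ (inj₁ (black x Px)) ; x (inj₂ refl) → x∈p∪q⁺ (inj₂ (x∈⁅x⁆ u)) }
    where
    step : ForceStep Γ C (C ∪ ⁅ u ⁆)
    step = v , u , black v Pv , u∉C , vu , (λ w vw w≢u → black w (others w vw w≢u)) , refl

  forced-all⇒zeroForcing : ∀ {S P} → Forced S P → (∀ v → P v) → IsZeroForcingSet Γ S
  forced-all⇒zeroForcing {S} (C , steps , black) all =
    subst (Star (ForceStep Γ) S) (⊆-antisym ⊆⊤ (λ {x} _ → black x (all x))) steps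

zeroForcingNumber-intro : ∀ {Γ k} S → IsZeroForcingSet Γ S → ∣ S ∣ ≤ k →
                          (∀ S′ → IsZeroForcingSet Γ S′ → k ≤ ∣ S′ ∣) → ZeroForcingNumber Γ k
zeroForcingNumber-intro S zfs ∣S∣≤k lower = (S , zfs , ≤-antisym ∣S∣≤k (lower S zfs)) , lower

-- Membership of the vertex numbered y; false when y is out of range.
memberℕ : ∀ {k} → Subset k → ℕ → Bool
memberℕ [] y = false
memberℕ (b ∷ S) zero = b
memberℕ (b ∷ S) (suc y) = memberℕ S y

indicator : Bool → ℕ
indicator true = 1
indicator false = 0

memberℕ-true : ∀ {k} (S : Subset k) (v : Fin k) → v ∈ S → memberℕ S (toℕ v) ≡ true
memberℕ-true (b ∷ S) Fin.zero here = refl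
memberℕ-true (b ∷ S) (Fin.suc v) (there v∈S) = memberℕ-true S v v∈S

memberℕ-false⇒∉ : ∀ {k} (S : Subset k) (v : Fin k) → memberℕ S (toℕ v) ≡ false → v ∉ S
memberℕ-false⇒∉ S v eq v∈S with trans (sym (memberℕ-true S v v∈S)) eq
... | ()

memberℕ-∅ : ∀ {k} z → memberℕ (∅ {k}) z ≡ false
memberℕ-∅ {zero} z = refl
memberℕ-∅ {suc k} zero = refl
memberℕ-∅ {suc k} (suc z) = memberℕ-∅ {k} z

memberℕ-⁅⁆ : ∀ {k} (v : Fin k) z → memberℕ ⁅ v ⁆ z ≡ true → z ≡ toℕ v
memberℕ-⁅⁆ Fin.zero zero _ = refl
memberℕ-⁅⁆ {suc k} Fin.zero (suc z) eq with () ← trans (sym (memberℕ-∅ {k} z)) eq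
memberℕ-⁅⁆ (Fin.suc v) zero ()
memberℕ-⁅⁆ (Fin.suc v) (suc z) eq = cong suc (memberℕ-⁅⁆ v z eq)

countFrom : ∀ {k} → Subset k → ℕ → ℕ → ℕ
countFrom S a zero = 0
countFrom S a (suc l) = indicator (memberℕ S a) + countFrom S (suc a) l

countFrom-+ : ∀ {k} (S : Subset k) a p q → countFrom S a (p + q) ≡ countFrom S a p + countFrom S (a + p) q
countFrom-+ S a zero q = cong (λ z → countFrom S z q) (sym (+-identityʳ a))
countFrom-+ S a (suc p) q rewrite countFrom-+ S (suc a) p q | +-suc a p =
  sym (+-assoc (indicator (memberℕ S a)) _ _)

countFrom-∷ : ∀ {k} (b : Bool) (S : Subset k) a l → countFrom (b ∷ S) (suc a) l ≡ countFrom S a l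
countFrom-∷ b S a zero = refl
countFrom-∷ b S a (suc l) = cong (indicator (memberℕ S a) +_) (countFrom-∷ b S (suc a) l)

countFrom-all : ∀ {k} (S : Subset k) → countFrom S 0 k ≡ ∣ S ∣
countFrom-all [] = refl
countFrom-all {suc k} (true ∷ S) = cong suc (trans (countFrom-∷ true S 0 k) (countFrom-all S))
countFrom-all {suc k} (false ∷ S) = trans (countFrom-∷ false S 0 k) (countFrom-all S)

∣p∪q∣≤∣p∣+∣q∣ : ∀ {k} (p q : Subset k) → ∣ p ∪ q ∣ ≤ ∣ p ∣ + ∣ q ∣
∣p∪q∣≤∣p∣+∣q∣ [] [] = z≤n
∣p∪q∣≤∣p∣+∣q∣ (true ∷ p) (true ∷ q) = s≤s (≤-trans (∣p∪q∣≤∣p∣+∣q∣ p q) (+-monoʳ-≤ ∣ p ∣ (n≤1+n ∣ q ∣)))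
∣p∪q∣≤∣p∣+∣q∣ (true ∷ p) (false ∷ q) = s≤s (∣p∪q∣≤∣p∣+∣q∣ p q)
∣p∪q∣≤∣p∣+∣q∣ (false ∷ p) (true ∷ q) = ≤-trans (s≤s (∣p∪q∣≤∣p∣+∣q∣ p q)) (≤-reflexive (sym (+-suc _ _)))
∣p∪q∣≤∣p∣+∣q∣ (false ∷ p) (false ∷ q) = ∣p∪q∣≤∣p∣+∣q∣ p q

countFrom-4 : ∀ {k} (S : Subset k) a C →
  countFrom S a (4 * C) ≡ countFrom S a C + countFrom S (a + C) C + countFrom S (a + 2 * C) C + countFrom S (a + 3 * C) C
countFrom-4 S a C = begin
    # a (4 * C)                                   ≡⟨ cong (# a) (eq₁ C) ⟩
    # a (C + (C + (C + C)))                       ≡⟨ countFrom-+ S a C _ ⟩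
    # a C + # (a + C) (C + (C + C))               ≡⟨ cong (# a C +_) (countFrom-+ S (a + C) C _) ⟩
    # a C + (# (a + C) C + # (a + C + C) (C + C)) ≡⟨ cong (λ z → # a C + (# (a + C) C + z)) (countFrom-+ S (a + C + C) C C) ⟩
    # a C + (# (a + C) C + (# (a + C + C) C + # (a + C + C + C) C))
      ≡⟨ cong₂ (λ u v → # a C + (# (a + C) C + (# u C + # v C))) (eq₂ a C) (eq₃ a C) ⟩
    # a C + (# (a + C) C + (# (a + 2 * C) C + # (a + 3 * C) C))
      ≡⟨ sym (trans (+-assoc (# a C + # (a + C) C) _ _) (+-assoc (# a C) _ _)) ⟩
    # a C + # (a + C) C + # (a + 2 * C) C + # (a + 3 * C) C ∎
  where
  open ≡-Reasoning
  # = countFrom S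
  eq₁ : ∀ C → 4 * C ≡ C + (C + (C + C))
  eq₁ = solve-∀
  eq₂ : ∀ a C → a + C + C ≡ a + 2 * C
  eq₂ = solve-∀
  eq₃ : ∀ a C → a + C + C + C ≡ a + 3 * C
  eq₃ = solve-∀

module Heap (m0 : ℕ) where

  n : ℕ
  n = suc m0

  T L firstLeaf order : ℕ
  T = treeSize n
  L = leafCount n
  firstLeaf = L ∸ 1
  order = T + 4 * L

  Edge : ℕ → ℕ → Set
  Edge = GEdge n

  Adjℕ : ℕ → ℕ → Set
  Adjℕ v w = Edge v w ⊎ Edge w v

  Adjℕ-sym : ∀ {v w} → Adjℕ v w → Adjℕ w v
  Adjℕ-sym (inj₁ e) = inj₂ e
  Adjℕ-sym (inj₂ e) = inj₁ e

  depth-eq : depth n ≡ suc (m0 + m0)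
  depth-eq = eq₁ m0
    where
    eq₁ : ∀ m → m + 1 * suc m ≡ suc (m + m)
    eq₁ = solve-∀

  L-eq : L ≡ 2 ^ (m0 + m0)
  L-eq rewrite depth-eq = refl

  4^m≡2^[m+m] : ∀ m → 4 ^ m ≡ 2 ^ (m + m)
  4^m≡2^[m+m] zero = refl
  4^m≡2^[m+m] (suc m) rewrite +-suc m m | 4^m≡2^[m+m] m = 4*q≡2*[2*q] (2 ^ (m + m))
    where
    4*q≡2*[2*q] : ∀ q → 4 * q ≡ 2 * (2 * q)
    4*q≡2*[2*q] = solve-∀

  L≡4^m0 : L ≡ 4 ^ m0
  L≡4^m0 = trans L-eq (sym (4^m≡2^[m+m] m0))

  1≤L : 1 ≤ L
  1≤L = subst (1 ≤_) (sym L-eq) (m^n>0 2 (m0 + m0))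

  L-suc : L ≡ suc firstLeaf
  L-suc = sym (m+[n∸m]≡n 1≤L)

  T-eq : T ≡ firstLeaf + L
  T-eq = begin
      2 ^ depth n ∸ 1               ≡⟨ cong (λ z → 2 ^ z ∸ 1) depth-eq ⟩
      2 * 2 ^ (m0 + m0) ∸ 1         ≡⟨ cong (λ z → 2 * z ∸ 1) (trans (sym L-eq) L-suc) ⟩
      2 * suc firstLeaf ∸ 1         ≡⟨ cong (λ z → firstLeaf + suc z) (+-identityʳ firstLeaf) ⟩
      firstLeaf + suc firstLeaf     ≡⟨ cong (firstLeaf +_) (sym L-suc) ⟩
      firstLeaf + L                 ∎
    where open ≡-Reasoning

  1≤T : 1 ≤ T
  1≤T = subst (1 ≤_) (sym T-eq) (≤-trans 1≤L (m≤n+m L firstLeaf))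

  left right ll lr rl rr : ℕ → ℕ
  left x = 2 * x + 1
  right x = 2 * x + 2
  ll x = left (left x)
  lr x = right (left x)
  rl x = left (right x)
  rr x = right (right x)

  Internal : ℕ → Set
  Internal x = right x < T

  Parent : ℕ → ℕ → Set
  Parent v x = x ≡ left v ⊎ x ≡ right v

  -- Block m x j: x roots a copy of B_(2m+1) inside the heap whose leaves are leaves j, …, j + 4^m − 1.
  Block : ℕ → ℕ → ℕ → Set
  Block zero x j = x ≡ firstLeaf + j × j < L
  Block (suc m) x j = Block m (ll x) j × Block m (lr x) (j + 4 ^ m) ×
                      Block m (rl x) (j + 2 * 4 ^ m) × Block m (rr x) (j + 3 * 4 ^ m)

  leaf<T : ∀ {j} → j < L → firstLeaf + j < T
  leaf<T {j} j<L rewrite T-eq = +-monoʳ-< firstLeaf j<L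

  x<rr : ∀ x → x < rr x
  x<rr x = ≤-trans (m≤m+n (suc x) (3 * x + 5)) (≤-reflexive (eq₁ x))
    where
    eq₁ : ∀ x → suc x + (3 * x + 5) ≡ 2 * (2 * x + 2) + 2
    eq₁ = solve-∀

  block<T : ∀ m x j → Block m x j → x < T
  block<T zero x j (refl , j<L) = leaf<T j<L
  block<T (suc m) x j (_ , _ , _ , B₄) = <-trans (x<rr x) (block<T m (rr x) _ B₄)

  block-internal : ∀ m x j → Block (suc m) x j → Internal x × Internal (left x) × Internal (right x)
  block-internal m x j (_ , B₂ , _ , B₄) =
    ≤-<-trans (right≤rr x) (block<T m _ _ B₄) , block<T m _ _ B₂ , block<T m _ _ B₄
    where
    right≤rr : ∀ x → 2 * x + 2 ≤ rr x
    right≤rr x = ≤-trans (m≤m+n (2 * x + 2) (2 * x + 4)) (≤-reflexive (eq₁ x))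
      where
      eq₁ : ∀ x → 2 * x + 2 + (2 * x + 4) ≡ 2 * (2 * x + 2) + 2
      eq₁ = solve-∀

  -- The vertex x is number i on level k of the heap, and 2m further levels lie below it.
  level-block : ∀ m k i x → suc x ≡ 2 ^ k + i → i < 2 ^ k → k + (m + m) ≡ m0 + m0 → Block m x (i * 4 ^ m)
  level-block zero k i x x-at i<2^k k≡ = x≡leaf , subst (_< L) (sym (*-identityʳ i)) i<L
    where
    2^k≡L : 2 ^ k ≡ L
    2^k≡L = trans (cong (2 ^_) (trans (sym (+-identityʳ k)) k≡)) (sym L-eq)
    i<L : i < L
    i<L = subst (i <_) 2^k≡L i<2^k
    x≡leaf : x ≡ firstLeaf + i * 1
    x≡leaf = suc-injective (begin
      suc x                   ≡⟨ x-at ⟩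
      2 ^ k + i               ≡⟨ cong (_+ i) (trans 2^k≡L L-suc) ⟩
      suc (firstLeaf + i)     ≡⟨ cong (λ z → suc (firstLeaf + z)) (sym (*-identityʳ i)) ⟩
      suc (firstLeaf + i * 1) ∎)
      where open ≡-Reasoning
  level-block (suc m) k i x x-at i<2^k k≡ =
    subst (Block m (ll x)) (offset0 i (4 ^ m)) (grandchild 0 (at0 x) (s≤s z≤n)) ,
    subst (Block m (lr x)) (offset1 i (4 ^ m)) (grandchild 1 (at1 x) (s≤s (s≤s z≤n))) ,
    subst (Block m (rl x)) (offset2 i (4 ^ m)) (grandchild 2 (at2 x) (s≤s (s≤s (s≤s z≤n)))) ,
    subst (Block m (rr x)) (offset3 i (4 ^ m)) (grandchild 3 (at3 x) (s≤s (s≤s (s≤s (s≤s z≤n)))))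
    where
    grandchild : ∀ r {y} → suc y ≡ 4 * suc x + r → r < 4 → Block m y ((4 * i + r) * 4 ^ m)
    grandchild r {y} y-at r<4 = level-block m (suc (suc k)) (4 * i + r) y
      (trans y-at (trans (cong (λ z → 4 * z + r) x-at) (level-shift (2 ^ k) i r)))
      (index-bound i (2 ^ k) r r<4 i<2^k)
      (trans (depth-shift k m) k≡)
      where
      level-shift : ∀ P i r → 4 * (P + i) + r ≡ 2 * (2 * P) + (4 * i + r)
      level-shift = solve-∀
      depth-shift : ∀ k m → suc (suc k) + (m + m) ≡ k + (suc m + suc m)
      depth-shift = solve-∀
      index-bound : ∀ i P r → r < 4 → i < P → 4 * i + r < 2 * (2 * P)
      index-bound i P r r<4 i<P =
        ≤-trans (+-monoʳ-< (4 * i) r<4) (≤-trans (≤-reflexive (eq₁ i)) (≤-trans (*-monoʳ-≤ 4 i<P) (≤-reflexive (eq₂ P))))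
        where
        eq₁ : ∀ i → 4 * i + 4 ≡ 4 * suc i
        eq₁ = solve-∀
        eq₂ : ∀ P → 4 * P ≡ 2 * (2 * P)
        eq₂ = solve-∀
    at0 : ∀ x → suc (2 * (2 * x + 1) + 1) ≡ 4 * suc x + 0
    at0 = solve-∀
    at1 : ∀ x → suc (2 * (2 * x + 1) + 2) ≡ 4 * suc x + 1
    at1 = solve-∀
    at2 : ∀ x → suc (2 * (2 * x + 2) + 1) ≡ 4 * suc x + 2
    at2 = solve-∀
    at3 : ∀ x → suc (2 * (2 * x + 2) + 2) ≡ 4 * suc x + 3
    at3 = solve-∀
    offset0 : ∀ i B → (4 * i + 0) * B ≡ i * (4 * B)
    offset0 = solve-∀
    offset1 : ∀ i B → (4 * i + 1) * B ≡ i * (4 * B) + B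
    offset1 = solve-∀
    offset2 : ∀ i B → (4 * i + 2) * B ≡ i * (4 * B) + 2 * B
    offset2 = solve-∀
    offset3 : ∀ i B → (4 * i + 3) * B ≡ i * (4 * B) + 3 * B
    offset3 = solve-∀

  block-root : Block m0 0 0
  block-root = level-block m0 0 0 0 refl (s≤s z≤n) refl

  gad-a gad-b gad-c gad-e : ℕ → ℕ
  gad-a j = T + 4 * j
  gad-b j = T + 4 * j + 1
  gad-c j = T + 4 * j + 2
  gad-e j = T + 4 * j + 3

  T≤gad-a : ∀ j → T ≤ gad-a j
  T≤gad-a j = m≤m+n T (4 * j)
  T≤gad-b : ∀ j → T ≤ gad-b j
  T≤gad-b j = ≤-trans (T≤gad-a j) (m≤m+n _ 1)
  T≤gad-c : ∀ j → T ≤ gad-c j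
  T≤gad-c j = ≤-trans (T≤gad-a j) (m≤m+n _ 2)
  T≤gad-e : ∀ j → T ≤ gad-e j
  T≤gad-e j = ≤-trans (T≤gad-a j) (m≤m+n _ 3)

  tree≢gadget : ∀ {y z} → y < T → T ≤ z → y ≢ z
  tree≢gadget y<T T≤z = <⇒≢ (<-≤-trans y<T T≤z)

  divMod4 : ℕ → ℕ × ℕ
  divMod4 (suc (suc (suc (suc k)))) = suc (proj₁ (divMod4 k)) , proj₂ (divMod4 k)
  divMod4 k = 0 , k

  private
    4*suc : ∀ j r → 4 * suc j + r ≡ suc (suc (suc (suc (4 * j + r))))
    4*suc = solve-∀

  divMod4-correct : ∀ j r → r < 4 → divMod4 (4 * j + r) ≡ (j , r)
  divMod4-correct zero zero _ = refl
  divMod4-correct zero (suc zero) _ = refl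
  divMod4-correct zero (suc (suc zero)) _ = refl
  divMod4-correct zero (suc (suc (suc zero))) _ = refl
  divMod4-correct zero (suc (suc (suc (suc r)))) (s≤s (s≤s (s≤s (s≤s ()))))
  divMod4-correct (suc j) r r<4 rewrite 4*suc j r | divMod4-correct j r r<4 = refl

  -- (index of the gadget, role) of a gadget vertex, with roles 0, 1, 2, 3 = a, b, c, e.
  gadgetRole : ℕ → ℕ × ℕ
  gadgetRole y = divMod4 (y ∸ T)

  gadgetRole-correct : ∀ j r → r < 4 → gadgetRole (T + 4 * j + r) ≡ (j , r)
  gadgetRole-correct j r r<4 rewrite +-assoc T (4 * j) r | m+n∸m≡n T (4 * j + r) = divMod4-correct j r r<4

  role-a : ∀ j → gadgetRole (gad-a j) ≡ (j , 0)
  role-a j = trans (cong gadgetRole (sym (+-identityʳ (T + 4 * j)))) (gadgetRole-correct j 0 (s≤s z≤n))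
  role-b : ∀ j → gadgetRole (gad-b j) ≡ (j , 1)
  role-b j = gadgetRole-correct j 1 (s≤s (s≤s z≤n))
  role-c : ∀ j → gadgetRole (gad-c j) ≡ (j , 2)
  role-c j = gadgetRole-correct j 2 (s≤s (s≤s (s≤s z≤n)))
  role-e : ∀ j → gadgetRole (gad-e j) ≡ (j , 3)
  role-e j = gadgetRole-correct j 3 (s≤s (s≤s (s≤s (s≤s z≤n))))

  private
    same-role : ∀ {y z a b} → gadgetRole y ≡ a → gadgetRole z ≡ b → y ≡ z → a ≡ b
    same-role p q refl = trans (sym p) q

  roles-differ : ∀ {y z j j′ r r′} → gadgetRole y ≡ (j′ , r′) → gadgetRole z ≡ (j , r) → r′ ≢ r → y ≢ z
  roles-differ p q r′≢r y≡z = r′≢r (cong proj₂ (same-role p q y≡z))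

  same-gadget : ∀ {y z j j′ r r′} → gadgetRole y ≡ (j′ , r′) → gadgetRole z ≡ (j , r) → y ≡ z → j′ ≡ j
  same-gadget p q y≡z = cong proj₁ (same-role p q y≡z)

  a≢b : ∀ j → gad-a j ≢ gad-b j
  a≢b j = roles-differ (role-a j) (role-b j) (λ ())
  a≢c : ∀ j → gad-a j ≢ gad-c j
  a≢c j = roles-differ (role-a j) (role-c j) (λ ())
  a≢e : ∀ j → gad-a j ≢ gad-e j
  a≢e j = roles-differ (role-a j) (role-e j) (λ ())
  b≢c : ∀ j → gad-b j ≢ gad-c j
  b≢c j = roles-differ (role-b j) (role-c j) (λ ())
  b≢e : ∀ j → gad-b j ≢ gad-e j
  b≢e j = roles-differ (role-b j) (role-e j) (λ ())
  c≢e : ∀ j → gad-c j ≢ gad-e j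
  c≢e j = roles-differ (role-c j) (role-e j) (λ ())

  left<T : ∀ {x} → Internal x → left x < T
  left<T {x} p = <-trans (+-monoʳ-< (2 * x) (s≤s (s≤s z≤n))) p

  internal<T : ∀ {x} → Internal x → x < T
  internal<T {x} p = ≤-<-trans (≤-trans (m≤m+n x (x + 0)) (m≤m+n _ 2)) p

  gadget-not-internal : ∀ {y} → T ≤ y → ¬ Internal y
  gadget-not-internal {y} T≤y p = <-irrefl refl (<-≤-trans p (≤-trans T≤y (≤-trans (m≤m+n y (y + 0)) (m≤m+n _ 2))))

  leaf-not-internal : ∀ {j} → ¬ Internal (firstLeaf + j)
  leaf-not-internal {j} p =
    <-irrefl refl (<-≤-trans p (≤-trans (≤-reflexive (trans T-eq (cong (firstLeaf +_) L-suc))) (leaf-bound firstLeaf j)))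
    where
    leaf-bound : ∀ a j → a + suc a ≤ 2 * (a + j) + 2
    leaf-bound a j = ≤-trans (≤-reflexive (eq₁ a)) (≤-trans (m≤m+n (2 * a + 1) (2 * j + 1)) (≤-reflexive (eq₂ a j)))
      where
      eq₁ : ∀ a → a + suc a ≡ 2 * a + 1
      eq₁ = solve-∀
      eq₂ : ∀ a j → 2 * a + 1 + (2 * j + 1) ≡ 2 * (a + j) + 2
      eq₂ = solve-∀

  -- The vertex is passed through an equation so that the edge, whose indices are not constructor
  -- patterns, can be matched on.
  nbrs-internal : ∀ {v x} → Internal x → Adjℕ v x → v ≡ left x ⊎ v ≡ right x ⊎ Parent v x
  nbrs-internal h (inj₁ (tree-left y p)) = inj₂ (inj₂ (inj₁ refl))
  nbrs-internal h (inj₁ (tree-right y p)) = inj₂ (inj₂ (inj₂ refl))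
  nbrs-internal h (inj₁ (leaf-a j p)) = ⊥-elim (gadget-not-internal (T≤gad-a j) h)
  nbrs-internal h (inj₁ (leaf-b j p)) = ⊥-elim (gadget-not-internal (T≤gad-b j) h)
  nbrs-internal h (inj₁ (a-c j p)) = ⊥-elim (gadget-not-internal (T≤gad-c j) h)
  nbrs-internal h (inj₁ (a-e j p)) = ⊥-elim (gadget-not-internal (T≤gad-e j) h)
  nbrs-internal h (inj₁ (b-c j p)) = ⊥-elim (gadget-not-internal (T≤gad-c j) h)
  nbrs-internal h (inj₁ (b-e j p)) = ⊥-elim (gadget-not-internal (T≤gad-e j) h)
  nbrs-internal h (inj₁ (c-e j p)) = ⊥-elim (gadget-not-internal (T≤gad-e j) h)
  nbrs-internal h (inj₂ (tree-left y p)) = inj₁ refl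
  nbrs-internal h (inj₂ (tree-right y p)) = inj₂ (inj₁ refl)
  nbrs-internal h (inj₂ (leaf-a j p)) = ⊥-elim (leaf-not-internal h)
  nbrs-internal h (inj₂ (leaf-b j p)) = ⊥-elim (leaf-not-internal h)
  nbrs-internal h (inj₂ (a-c j p)) = ⊥-elim (gadget-not-internal (T≤gad-a j) h)
  nbrs-internal h (inj₂ (a-e j p)) = ⊥-elim (gadget-not-internal (T≤gad-a j) h)
  nbrs-internal h (inj₂ (b-c j p)) = ⊥-elim (gadget-not-internal (T≤gad-b j) h)
  nbrs-internal h (inj₂ (b-e j p)) = ⊥-elim (gadget-not-internal (T≤gad-b j) h)
  nbrs-internal h (inj₂ (c-e j p)) = ⊥-elim (gadget-not-internal (T≤gad-c j) h)

  nbrs-leaf : ∀ {v y j} → j < L → y ≡ firstLeaf + j → Adjℕ v y → v ≡ gad-a j ⊎ v ≡ gad-b j ⊎ Parent v y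
  nbrs-leaf jL e (inj₁ (tree-left x p)) = inj₂ (inj₂ (inj₁ refl))
  nbrs-leaf jL e (inj₁ (tree-right x p)) = inj₂ (inj₂ (inj₂ refl))
  nbrs-leaf jL e (inj₁ (leaf-a j' p)) = ⊥-elim (tree≢gadget (leaf<T jL) (T≤gad-a j') (sym e))
  nbrs-leaf jL e (inj₁ (leaf-b j' p)) = ⊥-elim (tree≢gadget (leaf<T jL) (T≤gad-b j') (sym e))
  nbrs-leaf jL e (inj₁ (a-c j' p)) = ⊥-elim (tree≢gadget (leaf<T jL) (T≤gad-c j') (sym e))
  nbrs-leaf jL e (inj₁ (a-e j' p)) = ⊥-elim (tree≢gadget (leaf<T jL) (T≤gad-e j') (sym e))
  nbrs-leaf jL e (inj₁ (b-c j' p)) = ⊥-elim (tree≢gadget (leaf<T jL) (T≤gad-c j') (sym e))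
  nbrs-leaf jL e (inj₁ (b-e j' p)) = ⊥-elim (tree≢gadget (leaf<T jL) (T≤gad-e j') (sym e))
  nbrs-leaf jL e (inj₁ (c-e j' p)) = ⊥-elim (tree≢gadget (leaf<T jL) (T≤gad-e j') (sym e))
  nbrs-leaf jL e (inj₂ (tree-left x p)) = ⊥-elim (leaf-not-internal (subst (λ z → 2 * z + 2 < T) e p))
  nbrs-leaf jL e (inj₂ (tree-right x p)) = ⊥-elim (leaf-not-internal (subst (λ z → 2 * z + 2 < T) e p))
  nbrs-leaf jL e (inj₂ (leaf-a j' p)) = inj₁ (cong gad-a (+-cancelˡ-≡ firstLeaf _ _ e))
  nbrs-leaf jL e (inj₂ (leaf-b j' p)) = inj₂ (inj₁ (cong gad-b (+-cancelˡ-≡ firstLeaf _ _ e)))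
  nbrs-leaf jL e (inj₂ (a-c j' p)) = ⊥-elim (tree≢gadget (leaf<T jL) (T≤gad-a j') (sym e))
  nbrs-leaf jL e (inj₂ (a-e j' p)) = ⊥-elim (tree≢gadget (leaf<T jL) (T≤gad-a j') (sym e))
  nbrs-leaf jL e (inj₂ (b-c j' p)) = ⊥-elim (tree≢gadget (leaf<T jL) (T≤gad-b j') (sym e))
  nbrs-leaf jL e (inj₂ (b-e j' p)) = ⊥-elim (tree≢gadget (leaf<T jL) (T≤gad-b j') (sym e))
  nbrs-leaf jL e (inj₂ (c-e j' p)) = ⊥-elim (tree≢gadget (leaf<T jL) (T≤gad-c j') (sym e))

  nbrs-a : ∀ {v y j} → y ≡ gad-a j → Adjℕ v y → v ≡ firstLeaf + j ⊎ v ≡ gad-c j ⊎ v ≡ gad-e j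
  nbrs-a {j = j} e (inj₁ (tree-left x p)) = ⊥-elim (tree≢gadget (left<T {x} p) (T≤gad-a j) e)
  nbrs-a {j = j} e (inj₁ (tree-right x p)) = ⊥-elim (tree≢gadget p (T≤gad-a j) e)
  nbrs-a {j = j} e (inj₁ (leaf-a j' p)) = inj₁ (cong (firstLeaf +_) (same-gadget (role-a j') (role-a j) e))
  nbrs-a {j = j} e (inj₁ (leaf-b j' p)) = ⊥-elim (roles-differ (role-b j') (role-a j) (λ ()) e)
  nbrs-a {j = j} e (inj₁ (a-c j' p)) = ⊥-elim (roles-differ (role-c j') (role-a j) (λ ()) e)
  nbrs-a {j = j} e (inj₁ (a-e j' p)) = ⊥-elim (roles-differ (role-e j') (role-a j) (λ ()) e)
  nbrs-a {j = j} e (inj₁ (b-c j' p)) = ⊥-elim (roles-differ (role-c j') (role-a j) (λ ()) e)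
  nbrs-a {j = j} e (inj₁ (b-e j' p)) = ⊥-elim (roles-differ (role-e j') (role-a j) (λ ()) e)
  nbrs-a {j = j} e (inj₁ (c-e j' p)) = ⊥-elim (roles-differ (role-e j') (role-a j) (λ ()) e)
  nbrs-a {j = j} e (inj₂ (tree-left x p)) = ⊥-elim (tree≢gadget (internal<T {x} p) (T≤gad-a j) e)
  nbrs-a {j = j} e (inj₂ (tree-right x p)) = ⊥-elim (tree≢gadget (internal<T {x} p) (T≤gad-a j) e)
  nbrs-a {j = j} e (inj₂ (leaf-a j' p)) = ⊥-elim (tree≢gadget (leaf<T p) (T≤gad-a j) e)
  nbrs-a {j = j} e (inj₂ (leaf-b j' p)) = ⊥-elim (tree≢gadget (leaf<T p) (T≤gad-a j) e)
  nbrs-a {j = j} e (inj₂ (a-c j' p)) = inj₂ (inj₁ (cong gad-c (same-gadget (role-a j') (role-a j) e)))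
  nbrs-a {j = j} e (inj₂ (a-e j' p)) = inj₂ (inj₂ (cong gad-e (same-gadget (role-a j') (role-a j) e)))
  nbrs-a {j = j} e (inj₂ (b-c j' p)) = ⊥-elim (roles-differ (role-b j') (role-a j) (λ ()) e)
  nbrs-a {j = j} e (inj₂ (b-e j' p)) = ⊥-elim (roles-differ (role-b j') (role-a j) (λ ()) e)
  nbrs-a {j = j} e (inj₂ (c-e j' p)) = ⊥-elim (roles-differ (role-c j') (role-a j) (λ ()) e)

  nbrs-b : ∀ {v y j} → y ≡ gad-b j → Adjℕ v y → v ≡ firstLeaf + j ⊎ v ≡ gad-c j ⊎ v ≡ gad-e j
  nbrs-b {j = j} e (inj₁ (tree-left x p)) = ⊥-elim (tree≢gadget (left<T {x} p) (T≤gad-b j) e)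
  nbrs-b {j = j} e (inj₁ (tree-right x p)) = ⊥-elim (tree≢gadget p (T≤gad-b j) e)
  nbrs-b {j = j} e (inj₁ (leaf-a j' p)) = ⊥-elim (roles-differ (role-a j') (role-b j) (λ ()) e)
  nbrs-b {j = j} e (inj₁ (leaf-b j' p)) = inj₁ (cong (firstLeaf +_) (same-gadget (role-b j') (role-b j) e))
  nbrs-b {j = j} e (inj₁ (a-c j' p)) = ⊥-elim (roles-differ (role-c j') (role-b j) (λ ()) e)
  nbrs-b {j = j} e (inj₁ (a-e j' p)) = ⊥-elim (roles-differ (role-e j') (role-b j) (λ ()) e)
  nbrs-b {j = j} e (inj₁ (b-c j' p)) = ⊥-elim (roles-differ (role-c j') (role-b j) (λ ()) e)
  nbrs-b {j = j} e (inj₁ (b-e j' p)) = ⊥-elim (roles-differ (role-e j') (role-b j) (λ ()) e)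
  nbrs-b {j = j} e (inj₁ (c-e j' p)) = ⊥-elim (roles-differ (role-e j') (role-b j) (λ ()) e)
  nbrs-b {j = j} e (inj₂ (tree-left x p)) = ⊥-elim (tree≢gadget (internal<T {x} p) (T≤gad-b j) e)
  nbrs-b {j = j} e (inj₂ (tree-right x p)) = ⊥-elim (tree≢gadget (internal<T {x} p) (T≤gad-b j) e)
  nbrs-b {j = j} e (inj₂ (leaf-a j' p)) = ⊥-elim (tree≢gadget (leaf<T p) (T≤gad-b j) e)
  nbrs-b {j = j} e (inj₂ (leaf-b j' p)) = ⊥-elim (tree≢gadget (leaf<T p) (T≤gad-b j) e)
  nbrs-b {j = j} e (inj₂ (a-c j' p)) = ⊥-elim (roles-differ (role-a j') (role-b j) (λ ()) e)
  nbrs-b {j = j} e (inj₂ (a-e j' p)) = ⊥-elim (roles-differ (role-a j') (role-b j) (λ ()) e)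
  nbrs-b {j = j} e (inj₂ (b-c j' p)) = inj₂ (inj₁ (cong gad-c (same-gadget (role-b j') (role-b j) e)))
  nbrs-b {j = j} e (inj₂ (b-e j' p)) = inj₂ (inj₂ (cong gad-e (same-gadget (role-b j') (role-b j) e)))
  nbrs-b {j = j} e (inj₂ (c-e j' p)) = ⊥-elim (roles-differ (role-c j') (role-b j) (λ ()) e)

  nbrs-c : ∀ {v y j} → y ≡ gad-c j → Adjℕ v y → v ≡ gad-a j ⊎ v ≡ gad-b j ⊎ v ≡ gad-e j
  nbrs-c {j = j} e (inj₁ (tree-left x p)) = ⊥-elim (tree≢gadget (left<T {x} p) (T≤gad-c j) e)
  nbrs-c {j = j} e (inj₁ (tree-right x p)) = ⊥-elim (tree≢gadget p (T≤gad-c j) e)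
  nbrs-c {j = j} e (inj₁ (leaf-a j' p)) = ⊥-elim (roles-differ (role-a j') (role-c j) (λ ()) e)
  nbrs-c {j = j} e (inj₁ (leaf-b j' p)) = ⊥-elim (roles-differ (role-b j') (role-c j) (λ ()) e)
  nbrs-c {j = j} e (inj₁ (a-c j' p)) = inj₁ (cong gad-a (same-gadget (role-c j') (role-c j) e))
  nbrs-c {j = j} e (inj₁ (a-e j' p)) = ⊥-elim (roles-differ (role-e j') (role-c j) (λ ()) e)
  nbrs-c {j = j} e (inj₁ (b-c j' p)) = inj₂ (inj₁ (cong gad-b (same-gadget (role-c j') (role-c j) e)))
  nbrs-c {j = j} e (inj₁ (b-e j' p)) = ⊥-elim (roles-differ (role-e j') (role-c j) (λ ()) e)
  nbrs-c {j = j} e (inj₁ (c-e j' p)) = ⊥-elim (roles-differ (role-e j') (role-c j) (λ ()) e)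
  nbrs-c {j = j} e (inj₂ (tree-left x p)) = ⊥-elim (tree≢gadget (internal<T {x} p) (T≤gad-c j) e)
  nbrs-c {j = j} e (inj₂ (tree-right x p)) = ⊥-elim (tree≢gadget (internal<T {x} p) (T≤gad-c j) e)
  nbrs-c {j = j} e (inj₂ (leaf-a j' p)) = ⊥-elim (tree≢gadget (leaf<T p) (T≤gad-c j) e)
  nbrs-c {j = j} e (inj₂ (leaf-b j' p)) = ⊥-elim (tree≢gadget (leaf<T p) (T≤gad-c j) e)
  nbrs-c {j = j} e (inj₂ (a-c j' p)) = ⊥-elim (roles-differ (role-a j') (role-c j) (λ ()) e)
  nbrs-c {j = j} e (inj₂ (a-e j' p)) = ⊥-elim (roles-differ (role-a j') (role-c j) (λ ()) e)
  nbrs-c {j = j} e (inj₂ (b-c j' p)) = ⊥-elim (roles-differ (role-b j') (role-c j) (λ ()) e)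
  nbrs-c {j = j} e (inj₂ (b-e j' p)) = ⊥-elim (roles-differ (role-b j') (role-c j) (λ ()) e)
  nbrs-c {j = j} e (inj₂ (c-e j' p)) = inj₂ (inj₂ (cong gad-e (same-gadget (role-c j') (role-c j) e)))

  nbrs-e : ∀ {v y j} → y ≡ gad-e j → Adjℕ v y → v ≡ gad-a j ⊎ v ≡ gad-b j ⊎ v ≡ gad-c j
  nbrs-e {j = j} e (inj₁ (tree-left x p)) = ⊥-elim (tree≢gadget (left<T {x} p) (T≤gad-e j) e)
  nbrs-e {j = j} e (inj₁ (tree-right x p)) = ⊥-elim (tree≢gadget p (T≤gad-e j) e)
  nbrs-e {j = j} e (inj₁ (leaf-a j' p)) = ⊥-elim (roles-differ (role-a j') (role-e j) (λ ()) e)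
  nbrs-e {j = j} e (inj₁ (leaf-b j' p)) = ⊥-elim (roles-differ (role-b j') (role-e j) (λ ()) e)
  nbrs-e {j = j} e (inj₁ (a-c j' p)) = ⊥-elim (roles-differ (role-c j') (role-e j) (λ ()) e)
  nbrs-e {j = j} e (inj₁ (a-e j' p)) = inj₁ (cong gad-a (same-gadget (role-e j') (role-e j) e))
  nbrs-e {j = j} e (inj₁ (b-c j' p)) = ⊥-elim (roles-differ (role-c j') (role-e j) (λ ()) e)
  nbrs-e {j = j} e (inj₁ (b-e j' p)) = inj₂ (inj₁ (cong gad-b (same-gadget (role-e j') (role-e j) e)))
  nbrs-e {j = j} e (inj₁ (c-e j' p)) = inj₂ (inj₂ (cong gad-c (same-gadget (role-e j') (role-e j) e)))
  nbrs-e {j = j} e (inj₂ (tree-left x p)) = ⊥-elim (tree≢gadget (internal<T {x} p) (T≤gad-e j) e)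
  nbrs-e {j = j} e (inj₂ (tree-right x p)) = ⊥-elim (tree≢gadget (internal<T {x} p) (T≤gad-e j) e)
  nbrs-e {j = j} e (inj₂ (leaf-a j' p)) = ⊥-elim (tree≢gadget (leaf<T p) (T≤gad-e j) e)
  nbrs-e {j = j} e (inj₂ (leaf-b j' p)) = ⊥-elim (tree≢gadget (leaf<T p) (T≤gad-e j) e)
  nbrs-e {j = j} e (inj₂ (a-c j' p)) = ⊥-elim (roles-differ (role-a j') (role-e j) (λ ()) e)
  nbrs-e {j = j} e (inj₂ (a-e j' p)) = ⊥-elim (roles-differ (role-a j') (role-e j) (λ ()) e)
  nbrs-e {j = j} e (inj₂ (b-c j' p)) = ⊥-elim (roles-differ (role-b j') (role-e j) (λ ()) e)
  nbrs-e {j = j} e (inj₂ (b-e j' p)) = ⊥-elim (roles-differ (role-b j') (role-e j) (λ ()) e)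
  nbrs-e {j = j} e (inj₂ (c-e j' p)) = ⊥-elim (roles-differ (role-c j') (role-e j) (λ ()) e)

  left≢right : ∀ {a b} → left a ≢ right b
  left≢right {a} {b} eq = even≢odd (suc b) a (begin
      2 * suc b   ≡⟨ eq₁ b ⟩
      2 * b + 2   ≡⟨ sym eq ⟩
      2 * a + 1   ≡⟨ +-comm (2 * a) 1 ⟩
      suc (2 * a) ∎)
    where
    open ≡-Reasoning
    eq₁ : ∀ b → 2 * suc b ≡ 2 * b + 2
    eq₁ = solve-∀

  left-injective : ∀ {a b} → left a ≡ left b → a ≡ b
  left-injective {a} {b} eq = *-cancelˡ-≡ a b 2 (+-cancelʳ-≡ 1 (2 * a) (2 * b) eq)

  right-injective : ∀ {a b} → right a ≡ right b → a ≡ b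
  right-injective {a} {b} eq = *-cancelˡ-≡ a b 2 (+-cancelʳ-≡ 2 (2 * a) (2 * b) eq)

  Parent-unique : ∀ {v v′ y} → Parent v y → Parent v′ y → v ≡ v′
  Parent-unique {v} {v′} (inj₁ e) (inj₁ e′) = left-injective {v} {v′} (trans (sym e) e′)
  Parent-unique {v} {v′} (inj₁ e) (inj₂ e′) = ⊥-elim (left≢right {v} {v′} (trans (sym e) e′))
  Parent-unique {v} {v′} (inj₂ e) (inj₁ e′) = ⊥-elim (left≢right {v′} {v} (trans (sym e′) e))
  Parent-unique {v} {v′} (inj₂ e) (inj₂ e′) = right-injective {v} {v′} (trans (sym e) e′)

  Parent⇒< : ∀ {u g} → Parent u g → u < g
  Parent⇒< {u} (inj₁ refl) = ≤-trans (s≤s (m≤m+n u (u + 0))) (≤-reflexive (+-comm 1 (2 * u)))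
  Parent⇒< {u} (inj₂ refl) = ≤-trans (s≤s (m≤m+n u (u + 0))) (≤-trans (n≤1+n _) (≤-reflexive (+-comm 2 (2 * u))))

  Parent? : ∀ v y → Dec (Parent v y)
  Parent? v y with y ≟ left v | y ≟ right v
  ... | yes e | _ = yes (inj₁ e)
  ... | no _ | yes e = yes (inj₂ e)
  ... | no ¬e₁ | no ¬e₂ = no λ { (inj₁ e) → ¬e₁ e ; (inj₂ e) → ¬e₂ e }

  ¬Parent-root : ∀ {v} → ¬ Parent v 0
  ¬Parent-root {v} (inj₁ e) with trans e (+-comm (2 * v) 1)
  ... | ()
  ¬Parent-root {v} (inj₂ e) with trans e (+-comm (2 * v) 2)
  ... | ()

  Parent-edge : ∀ {u g} → Parent u g → Internal u → Adjℕ u g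
  Parent-edge {u} (inj₁ refl) p = inj₁ (tree-left u p)
  Parent-edge {u} (inj₂ refl) p = inj₁ (tree-right u p)

  tree<order : ∀ {y} → y < T → y < order
  tree<order p = ≤-trans p (m≤m+n T (4 * L))

  gadget<order : ∀ {j} r → j < L → r < 4 → T + 4 * j + r < order
  gadget<order {j} r j<L r<4 rewrite +-assoc T (4 * j) r =
    +-monoʳ-< T (≤-trans (+-monoʳ-< (4 * j) r<4) (≤-trans (≤-reflexive (eq₁ j)) (*-monoʳ-≤ 4 j<L)))
    where
    eq₁ : ∀ j → 4 * j + 4 ≡ 4 * suc j
    eq₁ = solve-∀

  gad-a<order : ∀ {j} → j < L → gad-a j < order
  gad-a<order {j} j<L = subst (_< order) (+-identityʳ (T + 4 * j)) (gadget<order 0 j<L (s≤s z≤n))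
  gad-b<order : ∀ {j} → j < L → gad-b j < order
  gad-b<order j<L = gadget<order 1 j<L (s≤s (s≤s z≤n))
  gad-c<order : ∀ {j} → j < L → gad-c j < order
  gad-c<order j<L = gadget<order 2 j<L (s≤s (s≤s (s≤s z≤n)))
  gad-e<order : ∀ {j} → j < L → gad-e j < order
  gad-e<order j<L = gadget<order 3 j<L (s≤s (s≤s (s≤s (s≤s z≤n))))

  edge<order : ∀ {a b} → Edge a b → a < order × b < order
  edge<order (tree-left x p) = tree<order (internal<T {x} p) , tree<order (left<T {x} p)
  edge<order (tree-right x p) = tree<order (internal<T {x} p) , tree<order p
  edge<order (leaf-a j p) = tree<order (leaf<T p) , gad-a<order p
  edge<order (leaf-b j p) = tree<order (leaf<T p) , gad-b<order p
  edge<order (a-c j p) = gad-a<order p , gad-c<order p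
  edge<order (a-e j p) = gad-a<order p , gad-e<order p
  edge<order (b-c j p) = gad-b<order p , gad-c<order p
  edge<order (b-e j p) = gad-b<order p , gad-e<order p
  edge<order (c-e j p) = gad-c<order p , gad-e<order p

  Adjℕ<order : ∀ {a b} → Adjℕ a b → b < order
  Adjℕ<order (inj₁ e) = proj₂ (edge<order e)
  Adjℕ<order (inj₂ e) = proj₁ (edge<order e)

  levels : ℕ → ℕ
  levels zero = 1
  levels (suc m) = suc (suc (levels m))

  levels-eq : ∀ m → levels m ≡ suc (m + m)
  levels-eq zero = refl
  levels-eq (suc m) rewrite levels-eq m | +-suc m m = refl

  -- Total width of the h heap levels starting with the level of y, from y onwards.
  span : ℕ → ℕ → ℕ
  span y zero = 0
  span y (suc h) = suc y + span (2 * y + 1) h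

  span-eq : ∀ h y → suc (y + span y h) ≡ suc y * 2 ^ h
  span-eq zero y = trans (cong suc (+-identityʳ y)) (sym (*-identityʳ (suc y)))
  span-eq (suc h) y = trans (cong suc (eq₁ y (span (2 * y + 1) h))) (trans (span-eq h (2 * y + 1)) (eq₂ y (2 ^ h)))
    where
    eq₁ : ∀ y z → y + (suc y + z) ≡ 2 * y + 1 + z
    eq₁ = solve-∀
    eq₂ : ∀ y p → suc (2 * y + 1) * p ≡ suc y * (2 * p)
    eq₂ = solve-∀

  span-root : span 0 (levels m0) ≡ T
  span-root = begin
      span 0 (levels m0)           ≡⟨ sym (m+n∸n≡m (span 0 (levels m0)) 1) ⟩
      span 0 (levels m0) + 1 ∸ 1   ≡⟨ cong (_∸ 1) (+-comm (span 0 (levels m0)) 1) ⟩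
      suc (span 0 (levels m0)) ∸ 1 ≡⟨ cong (_∸ 1) (trans (span-eq (levels m0) 0) (+-identityʳ _)) ⟩
      2 ^ levels m0 ∸ 1            ≡⟨ cong (λ z → 2 ^ z ∸ 1) (trans (levels-eq m0) (sym depth-eq)) ⟩
      T                            ∎
    where open ≡-Reasoning

  AdjĜ : ℕ → ℕ → Set
  AdjĜ v w = GHatEdge n v w ⊎ GHatEdge n w v

  Adjℕ⇒AdjĜ : ∀ {v w} → Adjℕ v w → AdjĜ v w
  Adjℕ⇒AdjĜ (inj₁ e) = inj₁ (old e)
  Adjℕ⇒AdjĜ (inj₂ e) = inj₂ (old e)

  AdjĜ-cases : ∀ {v w} → AdjĜ v w → Adjℕ v w ⊎ (v ≡ 0 × w ≡ order) ⊎ (v ≡ order × w ≡ 0)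
  AdjĜ-cases (inj₁ (old e)) = inj₁ (inj₁ e)
  AdjĜ-cases (inj₁ root-y) = inj₂ (inj₁ (refl , refl))
  AdjĜ-cases (inj₂ (old e)) = inj₁ (inj₂ e)
  AdjĜ-cases (inj₂ root-y) = inj₂ (inj₂ (refl , refl))

  InBlock : ℕ → ℕ → ℕ → ℕ → Set
  InBlock zero x j y = y ≡ x ⊎ y ≡ gad-a j ⊎ y ≡ gad-b j ⊎ y ≡ gad-c j ⊎ y ≡ gad-e j
  InBlock (suc m) x j y = y ≡ x ⊎ y ≡ left x ⊎ y ≡ right x ⊎ InBlock m (ll x) j y ⊎ InBlock m (lr x) (j + 4 ^ m) y
                          ⊎ InBlock m (rl x) (j + 2 * 4 ^ m) y ⊎ InBlock m (rr x) (j + 3 * 4 ^ m) y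

  InBlock? : ∀ m x j y → Dec (InBlock m x j y)
  InBlock? zero x j y = y ≟ x ⊎-dec y ≟ gad-a j ⊎-dec y ≟ gad-b j ⊎-dec y ≟ gad-c j ⊎-dec y ≟ gad-e j
  InBlock? (suc m) x j y =
    y ≟ x ⊎-dec y ≟ left x ⊎-dec y ≟ right x ⊎-dec InBlock? m (ll x) j y ⊎-dec InBlock? m (lr x) (j + 4 ^ m) y
    ⊎-dec InBlock? m (rl x) (j + 2 * 4 ^ m) y ⊎-dec InBlock? m (rr x) (j + 3 * 4 ^ m) y

  InBlock-root : ∀ m x j → InBlock m x j x
  InBlock-root zero x j = inj₁ refl
  InBlock-root (suc m) x j = inj₁ refl

  nbrs-block-root : ∀ m x j → Block m x j → ∀ {w} → Adjℕ w x → InBlock m x j w ⊎ Parent w x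
  nbrs-block-root zero _ j (refl , j<L) wx with nbrs-leaf j<L refl wx
  ... | inj₁ refl = inj₁ (inj₂ (inj₁ refl))
  ... | inj₂ (inj₁ refl) = inj₁ (inj₂ (inj₂ (inj₁ refl)))
  ... | inj₂ (inj₂ w-x) = inj₂ w-x
  nbrs-block-root (suc m) x j block wx with nbrs-internal (proj₁ (block-internal m x j block)) wx
  ... | inj₁ refl = inj₁ (inj₂ (inj₁ refl))
  ... | inj₂ (inj₁ refl) = inj₁ (inj₂ (inj₂ (inj₁ refl)))
  ... | inj₂ (inj₂ w-x) = inj₂ w-x

module BlockCount (m0 : ℕ) {k : ℕ} (S : Subset k) where
  open Heap m0

  black : ℕ → Bool
  black = memberℕ S

  black# : ℕ → ℕ
  black# y = indicator (black y)

  count : ℕ → ℕ → ℕ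
  count = countFrom S

  blockCount : ℕ → ℕ → ℕ → ℕ
  blockCount zero x j = black# x + count (gad-a j) 4
  blockCount (suc m) x j =
    black# x + black# (left x) + black# (right x) + blockCount m (ll x) j + blockCount m (lr x) (j + 4 ^ m)
    + blockCount m (rl x) (j + 2 * 4 ^ m) + blockCount m (rr x) (j + 3 * 4 ^ m)

  -- Count over the heap ranges [y, y + w), [2y + 1, 2y + 1 + 2w), … of h consecutive levels.
  levelCount : ℕ → ℕ → ℕ → ℕ
  levelCount y w zero = 0
  levelCount y w (suc h) = count y w + levelCount (2 * y + 1) (2 * w) h

  private
    eq-shift : ∀ y w₁ → 2 * (y + w₁) + 1 ≡ 2 * y + 1 + 2 * w₁
    eq-shift = solve-∀
    eq-swap : ∀ a b c d → a + b + (c + d) ≡ a + c + (b + d)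
    eq-swap = solve-∀

  levelCount-split : ∀ h y w₁ w₂ → levelCount y (w₁ + w₂) h ≡ levelCount y w₁ h + levelCount (y + w₁) w₂ h
  levelCount-split zero y w₁ w₂ = refl
  levelCount-split (suc h) y w₁ w₂
    rewrite countFrom-+ S y w₁ w₂ | *-distribˡ-+ 2 w₁ w₂ | levelCount-split h (2 * y + 1) (2 * w₁) (2 * w₂)
          | eq-shift y w₁ =
    eq-swap (count y w₁) (count (y + w₁) w₂) (levelCount (2 * y + 1) (2 * w₁) h) (levelCount (2 * y + 1 + 2 * w₁) (2 * w₂) h)

  private
    eq-double : ∀ y → 2 * suc y ≡ suc (2 * y + 1)
    eq-double = solve-∀
    eq-next : ∀ y → y + suc y ≡ 2 * y + 1
    eq-next = solve-∀

  levelCount-contiguous : ∀ h y → levelCount y (suc y) h ≡ count y (span y h)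
  levelCount-contiguous zero y = refl
  levelCount-contiguous (suc h) y
    rewrite countFrom-+ S y (suc y) (span (2 * y + 1) h) | eq-double y | levelCount-contiguous h (2 * y + 1)
          | eq-next y = refl

  levelCount-grandchildren : ∀ h x →
    levelCount (ll x) 4 h ≡ levelCount (ll x) 1 h + levelCount (lr x) 1 h + levelCount (rl x) 1 h + levelCount (rr x) 1 h
  levelCount-grandchildren h x = begin
      levelCount (ll x) 4 h
        ≡⟨ levelCount-split h (ll x) 1 3 ⟩
      # (ll x) + levelCount (ll x + 1) 3 h
        ≡⟨ cong (# (ll x) +_) (trans (cong (λ z → levelCount z 3 h) (eq₁ x)) (levelCount-split h (lr x) 1 2)) ⟩
      # (ll x) + (# (lr x) + levelCount (lr x + 1) 2 h)
        ≡⟨ cong (λ z → # (ll x) + (# (lr x) + z)) (trans (cong (λ z → levelCount z 2 h) (eq₂ x)) (levelCount-split h (rl x) 1 1)) ⟩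
      # (ll x) + (# (lr x) + (# (rl x) + levelCount (rl x + 1) 1 h))
        ≡⟨ cong (λ z → # (ll x) + (# (lr x) + (# (rl x) + levelCount z 1 h))) (eq₃ x) ⟩
      # (ll x) + (# (lr x) + (# (rl x) + # (rr x)))
        ≡⟨ sym (trans (+-assoc (# (ll x) + # (lr x)) _ _) (+-assoc (# (ll x)) _ _)) ⟩
      # (ll x) + # (lr x) + # (rl x) + # (rr x) ∎
    where
    open ≡-Reasoning
    # : ℕ → ℕ
    # y = levelCount y 1 h
    eq₁ : ∀ x → 2 * (2 * x + 1) + 1 + 1 ≡ 2 * (2 * x + 1) + 2
    eq₁ = solve-∀
    eq₂ : ∀ x → 2 * (2 * x + 1) + 2 + 1 ≡ 2 * (2 * x + 2) + 1
    eq₂ = solve-∀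
    eq₃ : ∀ x → 2 * (2 * x + 2) + 1 + 1 ≡ 2 * (2 * x + 2) + 2
    eq₃ = solve-∀

  count-gadgets-4 : ∀ j B → count (gad-a j) (4 * (4 * B)) ≡
    count (gad-a j) (4 * B) + count (gad-a (j + B)) (4 * B) + count (gad-a (j + 2 * B)) (4 * B) + count (gad-a (j + 3 * B)) (4 * B)
  count-gadgets-4 j B = trans (countFrom-4 S (gad-a j) (4 * B))
    (cong₂ _+_ (cong₂ _+_ (cong (λ z → count (gad-a j) (4 * B) + count z (4 * B)) (eq₁ T j B))
                          (cong (λ z → count z (4 * B)) (eq₂ T j B)))
               (cong (λ z → count z (4 * B)) (eq₃ T j B)))
    where
    eq₁ : ∀ T j B → T + 4 * j + 4 * B ≡ T + 4 * (j + B)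
    eq₁ = solve-∀
    eq₂ : ∀ T j B → T + 4 * j + 2 * (4 * B) ≡ T + 4 * (j + 2 * B)
    eq₂ = solve-∀
    eq₃ : ∀ T j B → T + 4 * j + 3 * (4 * B) ≡ T + 4 * (j + 3 * B)
    eq₃ = solve-∀

  blockCount-ranges : ∀ m x j → blockCount m x j ≡ levelCount x 1 (levels m) + count (gad-a j) (4 * 4 ^ m)
  blockCount-ranges zero x j = cong (_+ count (gad-a j) 4) (sym (trans (+-identityʳ (black# x + 0)) (+-identityʳ (black# x))))
  blockCount-ranges (suc m) x j
    rewrite blockCount-ranges m (ll x) j | blockCount-ranges m (lr x) (j + 4 ^ m)
          | blockCount-ranges m (rl x) (j + 2 * 4 ^ m) | blockCount-ranges m (rr x) (j + 3 * 4 ^ m) = sym (begin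
      (black# x + 0) + (count (left x) 2 + levelCount (ll x) 4 h) + count (gad-a j) (4 * (4 * B))
        ≡⟨ cong₂ (λ u v → (black# x + 0) + u + v)
                 (cong₂ _+_ (count-children x) (levelCount-grandchildren h x)) (count-gadgets-4 j B) ⟩
      (black# x + 0) + (black# (left x) + black# (right x) + (t₁ + t₂ + t₃ + t₄)) + (g₁ + g₂ + g₃ + g₄)
        ≡⟨ rearrange (black# x) (black# (left x)) (black# (right x)) t₁ t₂ t₃ t₄ g₁ g₂ g₃ g₄ ⟩
      black# x + black# (left x) + black# (right x) + (t₁ + g₁) + (t₂ + g₂) + (t₃ + g₃) + (t₄ + g₄) ∎)
    where
    open ≡-Reasoning
    B = 4 ^ m
    h = levels m
    t₁ = levelCount (ll x) 1 h
    t₂ = levelCount (lr x) 1 h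
    t₃ = levelCount (rl x) 1 h
    t₄ = levelCount (rr x) 1 h
    g₁ = count (gad-a j) (4 * B)
    g₂ = count (gad-a (j + B)) (4 * B)
    g₃ = count (gad-a (j + 2 * B)) (4 * B)
    g₄ = count (gad-a (j + 3 * B)) (4 * B)
    count-children : ∀ x → count (left x) 2 ≡ black# (left x) + black# (right x)
    count-children x = cong (λ z → black# (left x) + z) (trans (+-identityʳ _) (cong black# (eq₁ x)))
      where
      eq₁ : ∀ x → suc (2 * x + 1) ≡ 2 * x + 2
      eq₁ = solve-∀
    rearrange : ∀ a b c t₁ t₂ t₃ t₄ g₁ g₂ g₃ g₄ →
      a + 0 + (b + c + (t₁ + t₂ + t₃ + t₄)) + (g₁ + g₂ + g₃ + g₄) ≡
      a + b + c + (t₁ + g₁) + (t₂ + g₂) + (t₃ + g₃) + (t₄ + g₄)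
    rearrange = solve-∀

  blockCount-root : blockCount m0 0 0 ≡ count 0 order
  blockCount-root = begin
      blockCount m0 0 0                                         ≡⟨ blockCount-ranges m0 0 0 ⟩
      levelCount 0 1 (levels m0) + count (T + 0) (4 * 4 ^ m0)
        ≡⟨ cong₂ _+_ (trans (levelCount-contiguous (levels m0) 0) (cong (count 0) span-root))
                     (cong₂ count (+-identityʳ T) (cong (4 *_) (sym L≡4^m0))) ⟩
      count 0 T + count T (4 * L)                               ≡⟨ sym (countFrom-+ S 0 T (4 * L)) ⟩
      count 0 order                                             ∎
    where open ≡-Reasoning

  count-gadget : ∀ j → count (gad-a j) 4 ≡ black# (gad-a j) + black# (gad-b j) + black# (gad-c j) + black# (gad-e j)
  count-gadget j = begin
      # (gad-a j) + (# (suc (gad-a j)) + (# (suc (suc (gad-a j))) + (# (suc (suc (suc (gad-a j)))) + 0)))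
        ≡⟨ cong₂ (λ u v → # (gad-a j) + (# u + v)) (eq₁ (gad-a j))
                 (cong₂ (λ u v → # u + (# v + 0)) (eq₂ (gad-a j)) (eq₃ (gad-a j))) ⟩
      # (gad-a j) + (# (gad-b j) + (# (gad-c j) + (# (gad-e j) + 0)))
        ≡⟨ eq₄ (# (gad-a j)) (# (gad-b j)) (# (gad-c j)) (# (gad-e j)) ⟩
      # (gad-a j) + # (gad-b j) + # (gad-c j) + # (gad-e j) ∎
    where
    open ≡-Reasoning
    # = black#
    eq₁ : ∀ y → suc y ≡ y + 1
    eq₁ = solve-∀
    eq₂ : ∀ y → suc (suc y) ≡ y + 2
    eq₂ = solve-∀
    eq₃ : ∀ y → suc (suc (suc y)) ≡ y + 3
    eq₃ = solve-∀
    eq₄ : ∀ a b c e → a + (b + (c + (e + 0))) ≡ a + b + c + e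
    eq₄ = solve-∀

  blockCount-white : ∀ m x j → (∀ y → InBlock m x j y → black y ≡ false) → blockCount m x j ≡ 0
  blockCount-white zero x j white
    rewrite count-gadget j | cong indicator (white x (inj₁ refl)) | cong indicator (white (gad-a j) (inj₂ (inj₁ refl)))
          | cong indicator (white (gad-b j) (inj₂ (inj₂ (inj₁ refl))))
          | cong indicator (white (gad-c j) (inj₂ (inj₂ (inj₂ (inj₁ refl)))))
          | cong indicator (white (gad-e j) (inj₂ (inj₂ (inj₂ (inj₂ refl))))) = refl
  blockCount-white (suc m) x j white
    rewrite cong indicator (white x (inj₁ refl)) | cong indicator (white (left x) (inj₂ (inj₁ refl)))
          | cong indicator (white (right x) (inj₂ (inj₂ (inj₁ refl))))
          | blockCount-white m (ll x) j (λ y y∈ → white y (inj₂ (inj₂ (inj₂ (inj₁ y∈)))))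
          | blockCount-white m (lr x) (j + 4 ^ m) (λ y y∈ → white y (inj₂ (inj₂ (inj₂ (inj₂ (inj₁ y∈))))))
          | blockCount-white m (rl x) (j + 2 * 4 ^ m) (λ y y∈ → white y (inj₂ (inj₂ (inj₂ (inj₂ (inj₂ (inj₁ y∈)))))))
          | blockCount-white m (rr x) (j + 3 * 4 ^ m) (λ y y∈ → white y (inj₂ (inj₂ (inj₂ (inj₂ (inj₂ (inj₂ y∈))))))) = refl

-- Every vertex of G_n lies in the root block: otherwise counting the singleton of that vertex block by
-- block would give 0 instead of 1.
InBlock-everything : ∀ m0 y → y < Heap.order m0 → Heap.InBlock m0 m0 0 0 y
InBlock-everything m0 y y<o with Heap.InBlock? m0 m0 0 0 y
... | yes y∈B = y∈B
... | no y∉B =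
  ⊥-elim (0≢1+n (trans (sym (blockCount-white m0 0 0 white)) (trans blockCount-root (trans (countFrom-all S) (∣⁅x⁆∣≡1 v)))))
  where
  v = fromℕ< y<o
  S = ⁅ v ⁆
  open BlockCount m0 S
  white : ∀ z → Heap.InBlock m0 m0 0 0 z → black z ≡ false
  white z z∈B with black z in black-z
  ... | false = refl
  ... | true = ⊥-elim (y∉B (subst (Heap.InBlock m0 m0 0 0) (trans (memberℕ-⁅⁆ v z black-z) (toℕ-fromℕ< y<o)) z∈B))

module Forts (m0 : ℕ) {k : ℕ} (S : Subset k) where
  open Heap m0
  open BlockCount m0 S

  White : (ℕ → Set) → Set
  White F = ∀ y → F y → black y ≡ false

  AnotherNbrIn : (ℕ → Set) → ℕ → ℕ → Set
  AnotherNbrIn F v u = Σ ℕ λ w → w ≢ u × Adjℕ v w × F w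

  -- The root 0 is excluded so that the fort is also one of Ĝ_n.
  record Fort : Set₁ where
    constructor fort
    field
      member  : ℕ → Set
      nonempty : Σ ℕ member
      bounds  : ∀ y → member y → 1 ≤ y × y < order
      white   : White member
      closed  : ∀ v u → ¬ member v → member u → Adjℕ v u → AnotherNbrIn member v u

  -- A fort of the component of x after deleting the edge to its parent.
  record PendantFort (x : ℕ) : Set₁ where
    constructor pendantFort
    field
      member : ℕ → Set
      root   : member x
      bounds : ∀ y → member y → x ≤ y × y < order
      white  : White member
      closed : ∀ v u → ¬ member v → ¬ Parent v x → member u → Adjℕ v u → AnotherNbrIn member v u

  two-nbrs : ∀ {F : ℕ → Set} {v} u p q → p ≢ q → F p → F q → Adjℕ v p → Adjℕ v q → AnotherNbrIn F v u
  two-nbrs u p q p≢q Fp Fq vp vq with u ≟ p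
  ... | yes refl = q , (λ q≡p → p≢q (sym q≡p)) , vq , Fq
  ... | no u≢p = p , (λ p≡u → u≢p (sym p≡u)) , vp , Fp

  twin-fort : ∀ p q → p ≢ q → 1 ≤ p → 1 ≤ q → p < order → q < order →
              (∀ {v} → Adjℕ v p → v ≢ q → Adjℕ v q) → (∀ {v} → Adjℕ v q → v ≢ p → Adjℕ v p) →
              black p ≡ false → black q ≡ false → Fort
  twin-fort p q p≢q 1≤p 1≤q p<o q<o p→q q→p white-p white-q = fort F (p , inj₁ refl) bounds white closed
    where
    F : ℕ → Set
    F y = y ≡ p ⊎ y ≡ q
    bounds : ∀ y → F y → 1 ≤ y × y < order
    bounds _ (inj₁ refl) = 1≤p , p<o
    bounds _ (inj₂ refl) = 1≤q , q<o
    white : White F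
    white _ (inj₁ refl) = white-p
    white _ (inj₂ refl) = white-q
    closed : ∀ v u → ¬ F v → F u → Adjℕ v u → AnotherNbrIn F v u
    closed v _ v∉F (inj₁ refl) vp = q , (λ q≡p → p≢q (sym q≡p)) , p→q vp (λ v≡q → v∉F (inj₂ v≡q)) , inj₂ refl
    closed v _ v∉F (inj₂ refl) vq = p , p≢q , q→p vq (λ v≡p → v∉F (inj₁ v≡p)) , inj₁ refl

  ab-fort : ∀ j → j < L → black (gad-a j) ≡ false → black (gad-b j) ≡ false → Fort
  ab-fort j j<L =
    twin-fort (gad-a j) (gad-b j) (a≢b j) (≤-trans 1≤T (T≤gad-a j)) (≤-trans 1≤T (T≤gad-b j))
      (gad-a<order j<L) (gad-b<order j<L) a→b b→a
    where
    a→b : ∀ {v} → Adjℕ v (gad-a j) → v ≢ gad-b j → Adjℕ v (gad-b j)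
    a→b va _ with nbrs-a {j = j} refl va
    ... | inj₁ refl = inj₁ (leaf-b j j<L)
    ... | inj₂ (inj₁ refl) = inj₂ (b-c j j<L)
    ... | inj₂ (inj₂ refl) = inj₂ (b-e j j<L)
    b→a : ∀ {v} → Adjℕ v (gad-b j) → v ≢ gad-a j → Adjℕ v (gad-a j)
    b→a vb _ with nbrs-b {j = j} refl vb
    ... | inj₁ refl = inj₁ (leaf-a j j<L)
    ... | inj₂ (inj₁ refl) = inj₂ (a-c j j<L)
    ... | inj₂ (inj₂ refl) = inj₂ (a-e j j<L)

  ce-fort : ∀ j → j < L → black (gad-c j) ≡ false → black (gad-e j) ≡ false → Fort
  ce-fort j j<L =
    twin-fort (gad-c j) (gad-e j) (c≢e j) (≤-trans 1≤T (T≤gad-c j)) (≤-trans 1≤T (T≤gad-e j))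
      (gad-c<order j<L) (gad-e<order j<L) c→e e→c
    where
    c→e : ∀ {v} → Adjℕ v (gad-c j) → v ≢ gad-e j → Adjℕ v (gad-e j)
    c→e vc v≢e with nbrs-c {j = j} refl vc
    ... | inj₁ refl = inj₁ (a-e j j<L)
    ... | inj₂ (inj₁ refl) = inj₁ (b-e j j<L)
    ... | inj₂ (inj₂ refl) = ⊥-elim (v≢e refl)
    e→c : ∀ {v} → Adjℕ v (gad-e j) → v ≢ gad-c j → Adjℕ v (gad-c j)
    e→c ve v≢c with nbrs-e {j = j} refl ve
    ... | inj₁ refl = inj₁ (a-c j j<L)
    ... | inj₂ (inj₁ refl) = inj₁ (b-c j j<L)
    ... | inj₂ (inj₂ refl) = ⊥-elim (v≢c refl)

  -- {x, p, q} for a leaf x, p ∈ {a, b} and q ∈ {c, e}; p′ and q′ are the two remaining gadget vertices.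
  leaf-pendant-fort : ∀ x p p′ q q′ → black x ≡ false → black p ≡ false → black q ≡ false →
    x ≢ q → p ≢ q → x ≤ p → x ≤ q → x < order → p < order → q < order →
    (∀ v → Adjℕ v x → v ≡ p ⊎ v ≡ p′ ⊎ Parent v x) →
    (∀ v → Adjℕ v p → v ≡ x ⊎ v ≡ q ⊎ v ≡ q′) →
    (∀ v → Adjℕ v q → v ≡ p ⊎ v ≡ p′ ⊎ v ≡ q′) →
    Adjℕ p′ x → Adjℕ p′ q → Adjℕ q′ p → Adjℕ q′ q → PendantFort x
  leaf-pendant-fort x p p′ q q′ white-x white-p white-q x≢q p≢q x≤p x≤q x<o p<o q<o nbrs-x nbrs-p nbrs-q
    p′x p′q q′p q′q = pendantFort F (inj₁ refl) bounds white closed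
    where
    F : ℕ → Set
    F y = y ≡ x ⊎ y ≡ p ⊎ y ≡ q
    bounds : ∀ y → F y → x ≤ y × y < order
    bounds _ (inj₁ refl) = ≤-refl , x<o
    bounds _ (inj₂ (inj₁ refl)) = x≤p , p<o
    bounds _ (inj₂ (inj₂ refl)) = x≤q , q<o
    white : White F
    white _ (inj₁ refl) = white-x
    white _ (inj₂ (inj₁ refl)) = white-p
    white _ (inj₂ (inj₂ refl)) = white-q
    closed : ∀ v u → ¬ F v → ¬ Parent v x → F u → Adjℕ v u → AnotherNbrIn F v u
    closed v _ v∉F v-not-parent (inj₁ refl) vx with nbrs-x v vx
    ... | inj₁ refl = ⊥-elim (v∉F (inj₂ (inj₁ refl)))
    ... | inj₂ (inj₁ refl) = two-nbrs x x q x≢q (inj₁ refl) (inj₂ (inj₂ refl)) p′x p′q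
    ... | inj₂ (inj₂ v-parent) = ⊥-elim (v-not-parent v-parent)
    closed v _ v∉F _ (inj₂ (inj₁ refl)) vp with nbrs-p v vp
    ... | inj₁ refl = ⊥-elim (v∉F (inj₁ refl))
    ... | inj₂ (inj₁ refl) = ⊥-elim (v∉F (inj₂ (inj₂ refl)))
    ... | inj₂ (inj₂ refl) = two-nbrs p p q p≢q (inj₂ (inj₁ refl)) (inj₂ (inj₂ refl)) q′p q′q
    closed v _ v∉F _ (inj₂ (inj₂ refl)) vq with nbrs-q v vq
    ... | inj₁ refl = ⊥-elim (v∉F (inj₂ (inj₁ refl)))
    ... | inj₂ (inj₁ refl) = two-nbrs q x q x≢q (inj₁ refl) (inj₂ (inj₂ refl)) p′x p′q
    ... | inj₂ (inj₂ refl) = two-nbrs q p q p≢q (inj₂ (inj₁ refl)) (inj₂ (inj₂ refl)) q′p q′q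

  private
    swap₁₂ : ∀ {X Y Z : Set} → X ⊎ Y ⊎ Z → Y ⊎ X ⊎ Z
    swap₁₂ (inj₁ x) = inj₂ (inj₁ x)
    swap₁₂ (inj₂ (inj₁ y)) = inj₁ y
    swap₁₂ (inj₂ (inj₂ z)) = inj₂ (inj₂ z)

    swap₂₃ : ∀ {X Y Z : Set} → X ⊎ Y ⊎ Z → X ⊎ Z ⊎ Y
    swap₂₃ (inj₁ x) = inj₁ x
    swap₂₃ (inj₂ (inj₁ y)) = inj₂ (inj₂ y)
    swap₂₃ (inj₂ (inj₂ z)) = inj₂ (inj₁ z)

  module LeafPendantForts (j : ℕ) (j<L : j < L) (white-leaf : black (firstLeaf + j) ≡ false) where
    private
      leaf<T′ : firstLeaf + j < T
      leaf<T′ = leaf<T j<L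
      leaf≤ : ∀ {y} → T ≤ y → firstLeaf + j ≤ y
      leaf≤ T≤y = <⇒≤ (<-≤-trans leaf<T′ T≤y)

    with-ac : black (gad-a j) ≡ false → black (gad-c j) ≡ false → PendantFort (firstLeaf + j)
    with-ac white-a white-c =
      leaf-pendant-fort (firstLeaf + j) (gad-a j) (gad-b j) (gad-c j) (gad-e j) white-leaf white-a white-c
        (tree≢gadget leaf<T′ (T≤gad-c j)) (a≢c j) (leaf≤ (T≤gad-a j)) (leaf≤ (T≤gad-c j))
        (tree<order leaf<T′) (gad-a<order j<L) (gad-c<order j<L)
        (λ v a → nbrs-leaf j<L refl a) (λ v a → nbrs-a {j = j} refl a) (λ v a → nbrs-c {j = j} refl a)
        (inj₂ (leaf-b j j<L)) (inj₁ (b-c j j<L)) (inj₂ (a-e j j<L)) (inj₂ (c-e j j<L))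

    with-ae : black (gad-a j) ≡ false → black (gad-e j) ≡ false → PendantFort (firstLeaf + j)
    with-ae white-a white-e =
      leaf-pendant-fort (firstLeaf + j) (gad-a j) (gad-b j) (gad-e j) (gad-c j) white-leaf white-a white-e
        (tree≢gadget leaf<T′ (T≤gad-e j)) (a≢e j) (leaf≤ (T≤gad-a j)) (leaf≤ (T≤gad-e j))
        (tree<order leaf<T′) (gad-a<order j<L) (gad-e<order j<L)
        (λ v a → nbrs-leaf j<L refl a) (λ v a → swap₂₃ (nbrs-a {j = j} refl a)) (λ v a → nbrs-e {j = j} refl a)
        (inj₂ (leaf-b j j<L)) (inj₁ (b-e j j<L)) (inj₂ (a-c j j<L)) (inj₁ (c-e j j<L))

    with-bc : black (gad-b j) ≡ false → black (gad-c j) ≡ false → PendantFort (firstLeaf + j)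
    with-bc white-b white-c =
      leaf-pendant-fort (firstLeaf + j) (gad-b j) (gad-a j) (gad-c j) (gad-e j) white-leaf white-b white-c
        (tree≢gadget leaf<T′ (T≤gad-c j)) (b≢c j) (leaf≤ (T≤gad-b j)) (leaf≤ (T≤gad-c j))
        (tree<order leaf<T′) (gad-b<order j<L) (gad-c<order j<L)
        (λ v a → swap₁₂ (nbrs-leaf j<L refl a)) (λ v a → nbrs-b {j = j} refl a) (λ v a → swap₁₂ (nbrs-c {j = j} refl a))
        (inj₂ (leaf-a j j<L)) (inj₁ (a-c j j<L)) (inj₂ (b-e j j<L)) (inj₂ (c-e j j<L))

    with-be : black (gad-b j) ≡ false → black (gad-e j) ≡ false → PendantFort (firstLeaf + j)
    with-be white-b white-e =
      leaf-pendant-fort (firstLeaf + j) (gad-b j) (gad-a j) (gad-e j) (gad-c j) white-leaf white-b white-e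
        (tree≢gadget leaf<T′ (T≤gad-e j)) (b≢e j) (leaf≤ (T≤gad-b j)) (leaf≤ (T≤gad-e j))
        (tree<order leaf<T′) (gad-b<order j<L) (gad-e<order j<L)
        (λ v a → swap₁₂ (nbrs-leaf j<L refl a)) (λ v a → swap₂₃ (nbrs-b {j = j} refl a)) (λ v a → swap₁₂ (nbrs-e {j = j} refl a))
        (inj₂ (leaf-a j j<L)) (inj₁ (a-e j j<L)) (inj₂ (b-c j j<L)) (inj₁ (c-e j j<L))

  -- The parent u, exempt in both pendant forts, has a neighbour in each of them.
  siblings-fort : ∀ u g g′ → Internal u → Parent u g → Parent u g′ → g ≢ g′ →
                  PendantFort g → PendantFort g′ → Fort
  siblings-fort u g g′ u-internal u-g u-g′ g≢g′ (pendantFort F₁ g∈F₁ bounds₁ white₁ closed₁)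
                                                (pendantFort F₂ g′∈F₂ bounds₂ white₂ closed₂) =
    fort F (g , inj₁ g∈F₁) bounds white closed
    where
    F : ℕ → Set
    F y = F₁ y ⊎ F₂ y
    bounds : ∀ y → F y → 1 ≤ y × y < order
    bounds y (inj₁ y∈F₁) = ≤-trans (s≤s z≤n) (≤-trans (Parent⇒< {u} u-g) (proj₁ (bounds₁ y y∈F₁))) , proj₂ (bounds₁ y y∈F₁)
    bounds y (inj₂ y∈F₂) = ≤-trans (s≤s z≤n) (≤-trans (Parent⇒< {u} u-g′) (proj₁ (bounds₂ y y∈F₂))) , proj₂ (bounds₂ y y∈F₂)
    white : White F
    white y (inj₁ y∈F₁) = white₁ y y∈F₁
    white y (inj₂ y∈F₂) = white₂ y y∈F₂
    at-u : ∀ w → AnotherNbrIn F u w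
    at-u w = two-nbrs w g g′ g≢g′ (inj₁ g∈F₁) (inj₂ g′∈F₂) (Parent-edge u-g u-internal) (Parent-edge u-g′ u-internal)
    closed : ∀ v w → ¬ F v → F w → Adjℕ v w → AnotherNbrIn F v w
    closed v w v∉F (inj₁ w∈F₁) vw with Parent? v g
    ... | yes v-g with refl ← Parent-unique {v} {u} v-g u-g = at-u w
    ... | no ¬v-g with closed₁ v w (λ v∈F₁ → v∉F (inj₁ v∈F₁)) ¬v-g w∈F₁ vw
    ...   | w′ , w′≢w , vw′ , w′∈F₁ = w′ , w′≢w , vw′ , inj₁ w′∈F₁
    closed v w v∉F (inj₂ w∈F₂) vw with Parent? v g′
    ... | yes v-g′ with refl ← Parent-unique {v} {u} v-g′ u-g′ = at-u w
    ... | no ¬v-g′ with closed₂ v w (λ v∈F₂ → v∉F (inj₂ v∈F₂)) ¬v-g′ w∈F₂ vw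
    ...   | w′ , w′≢w , vw′ , w′∈F₂ = w′ , w′≢w , vw′ , inj₂ w′∈F₂

  -- Each child of x, exempt in the pendant fort below it, sees x and its own child in the new set.
  grandchildren-pendant-fort : ∀ x g₁ g₂ → Internal x → Internal (left x) → Internal (right x) →
    black x ≡ false → Parent (left x) g₁ → Parent (right x) g₂ → PendantFort g₁ → PendantFort g₂ → PendantFort x
  grandchildren-pendant-fort x g₁ g₂ x-int l-int r-int white-x l-g₁ r-g₂
    (pendantFort F₁ g₁∈F₁ bounds₁ white₁ closed₁) (pendantFort F₂ g₂∈F₂ bounds₂ white₂ closed₂) =
    pendantFort F (inj₁ refl) bounds white closed
    where
    x<g₁ : x < g₁
    x<g₁ = <-trans (Parent⇒< {x} (inj₁ refl)) (Parent⇒< {left x} l-g₁)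
    x<g₂ : x < g₂
    x<g₂ = <-trans (Parent⇒< {x} (inj₂ refl)) (Parent⇒< {right x} r-g₂)
    F : ℕ → Set
    F y = y ≡ x ⊎ F₁ y ⊎ F₂ y
    bounds : ∀ y → F y → x ≤ y × y < order
    bounds _ (inj₁ refl) = ≤-refl , tree<order (internal<T {x} x-int)
    bounds y (inj₂ (inj₁ y∈F₁)) = ≤-trans (<⇒≤ x<g₁) (proj₁ (bounds₁ y y∈F₁)) , proj₂ (bounds₁ y y∈F₁)
    bounds y (inj₂ (inj₂ y∈F₂)) = ≤-trans (<⇒≤ x<g₂) (proj₁ (bounds₂ y y∈F₂)) , proj₂ (bounds₂ y y∈F₂)
    white : White F
    white _ (inj₁ refl) = white-x
    white y (inj₂ (inj₁ y∈F₁)) = white₁ y y∈F₁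
    white y (inj₂ (inj₂ y∈F₂)) = white₂ y y∈F₂
    at-left : ∀ w → AnotherNbrIn F (left x) w
    at-left w = two-nbrs w x g₁ (<⇒≢ x<g₁) (inj₁ refl) (inj₂ (inj₁ g₁∈F₁)) (inj₂ (tree-left x x-int)) (Parent-edge l-g₁ l-int)
    at-right : ∀ w → AnotherNbrIn F (right x) w
    at-right w = two-nbrs w x g₂ (<⇒≢ x<g₂) (inj₁ refl) (inj₂ (inj₂ g₂∈F₂)) (inj₂ (tree-right x x-int)) (Parent-edge r-g₂ r-int)
    closed : ∀ v w → ¬ F v → ¬ Parent v x → F w → Adjℕ v w → AnotherNbrIn F v w
    closed v _ _ ¬v-x (inj₁ refl) vx with nbrs-internal x-int vx
    ... | inj₁ refl = at-left x
    ... | inj₂ (inj₁ refl) = at-right x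
    ... | inj₂ (inj₂ v-x) = ⊥-elim (¬v-x v-x)
    closed v w v∉F _ (inj₂ (inj₁ w∈F₁)) vw with Parent? v g₁
    ... | yes v-g₁ with refl ← Parent-unique {v} {left x} v-g₁ l-g₁ = at-left w
    ... | no ¬v-g₁ with closed₁ v w (λ v∈F₁ → v∉F (inj₂ (inj₁ v∈F₁))) ¬v-g₁ w∈F₁ vw
    ...   | w′ , w′≢w , vw′ , w′∈F₁ = w′ , w′≢w , vw′ , inj₂ (inj₁ w′∈F₁)
    closed v w v∉F _ (inj₂ (inj₂ w∈F₂)) vw with Parent? v g₂
    ... | yes v-g₂ with refl ← Parent-unique {v} {right x} v-g₂ r-g₂ = at-right w
    ... | no ¬v-g₂ with closed₂ v w (λ v∈F₂ → v∉F (inj₂ (inj₂ v∈F₂))) ¬v-g₂ w∈F₂ vw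
    ...   | w′ , w′≢w , vw′ , w′∈F₂ = w′ , w′≢w , vw′ , inj₂ (inj₂ w′∈F₂)

  Outcome : ℕ → ℕ → ℕ → Set₁
  Outcome m x c = Fort ⊎ (PendantFort x × t (suc m) ≤ c) ⊎ t (suc m) < c

  ChildOutcome : ℕ → ℕ → ℕ → Set₁
  ChildOutcome m u c =
    Fort ⊎ ((Σ ℕ λ g → Parent u g × PendantFort g) × t (suc m) + suc (t (suc m)) ≤ c) ⊎ suc (t (suc m)) + suc (t (suc m)) ≤ c

  child-outcome : ∀ {m u c₁ c₂} → Internal u → Outcome m (left u) c₁ → Outcome m (right u) c₂ → ChildOutcome m u (c₁ + c₂)
  child-outcome _ (inj₁ F) _ = inj₁ F
  child-outcome _ (inj₂ _) (inj₁ F) = inj₁ F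
  child-outcome {u = u} u-int (inj₂ (inj₁ (P₁ , _))) (inj₂ (inj₁ (P₂ , _))) =
    inj₁ (siblings-fort u (left u) (right u) u-int (inj₁ refl) (inj₂ refl) (left≢right {u} {u}) P₁ P₂)
  child-outcome {u = u} _ (inj₂ (inj₁ (P₁ , t≤c₁))) (inj₂ (inj₂ t<c₂)) =
    inj₂ (inj₁ ((left u , inj₁ refl , P₁) , +-mono-≤ t≤c₁ t<c₂))
  child-outcome {m} {u} {c₁} {c₂} _ (inj₂ (inj₂ t<c₁)) (inj₂ (inj₁ (P₂ , t≤c₂))) =
    inj₂ (inj₁ ((right u , inj₂ refl , P₂) , subst (_≤ c₁ + c₂) (+-comm (suc (t (suc m))) (t (suc m))) (+-mono-≤ t<c₁ t≤c₂)))
  child-outcome _ (inj₂ (inj₂ t<c₁)) (inj₂ (inj₂ t<c₂)) = inj₂ (inj₂ (+-mono-≤ t<c₁ t<c₂))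

  private
    three≤ : ∀ {x k} → Outcome 0 x (3 + k)
    three≤ = inj₂ (inj₂ (s≤s (s≤s (s≤s z≤n))))

  -- At most one of a, b and one of c, e black, else a twin fort; the rest is counting.
  leaf-outcome : ∀ j → j < L → (bℓ ba bb bc be : Bool) → black (firstLeaf + j) ≡ bℓ →
    black (gad-a j) ≡ ba → black (gad-b j) ≡ bb → black (gad-c j) ≡ bc → black (gad-e j) ≡ be →
    Outcome 0 (firstLeaf + j) (indicator bℓ + (indicator ba + indicator bb + indicator bc + indicator be))
  leaf-outcome j j<L _ false false _ _ _ a b _ _ = inj₁ (ab-fort j j<L a b)
  leaf-outcome j j<L _ _ _ false false _ _ _ c e = inj₁ (ce-fort j j<L c e)
  leaf-outcome j j<L false true false true false ℓ _ b _ e = inj₂ (inj₁ (LeafPendantForts.with-be j j<L ℓ b e , ≤-refl))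
  leaf-outcome j j<L false true false false true ℓ _ b c _ = inj₂ (inj₁ (LeafPendantForts.with-bc j j<L ℓ b c , ≤-refl))
  leaf-outcome j j<L false false true true false ℓ a _ _ e = inj₂ (inj₁ (LeafPendantForts.with-ae j j<L ℓ a e , ≤-refl))
  leaf-outcome j j<L false false true false true ℓ a _ c _ = inj₂ (inj₁ (LeafPendantForts.with-ac j j<L ℓ a c , ≤-refl))
  leaf-outcome j j<L false true true true false _ _ _ _ _ = three≤
  leaf-outcome j j<L false true true false true _ _ _ _ _ = three≤
  leaf-outcome j j<L false true true true true _ _ _ _ _ = three≤
  leaf-outcome j j<L false true false true true _ _ _ _ _ = three≤
  leaf-outcome j j<L false false true true true _ _ _ _ _ = three≤
  leaf-outcome j j<L true true false true false _ _ _ _ _ = three≤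
  leaf-outcome j j<L true true false false true _ _ _ _ _ = three≤
  leaf-outcome j j<L true true false true true _ _ _ _ _ = three≤
  leaf-outcome j j<L true false true true false _ _ _ _ _ = three≤
  leaf-outcome j j<L true false true false true _ _ _ _ _ = three≤
  leaf-outcome j j<L true false true true true _ _ _ _ _ = three≤
  leaf-outcome j j<L true true true true false _ _ _ _ _ = three≤
  leaf-outcome j j<L true true true false true _ _ _ _ _ = three≤
  leaf-outcome j j<L true true true true true _ _ _ _ _ = three≤

  private
    sum≤ : ∀ d {a b c₁ c₂ c} → a ≤ c₁ → b ≤ c₂ → d + (c₁ + c₂) ≤ c → a + b ≤ c
    sum≤ d {c₁ = c₁} {c₂} a≤c₁ b≤c₂ count≤ = ≤-trans (+-mono-≤ a≤c₁ b≤c₂) (≤-trans (m≤n+m (c₁ + c₂) d) count≤)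
    pendant-pair : ∀ t → t + suc t + (t + suc t) ≡ 4 * t + 2
    pendant-pair = solve-∀
    pendant-many : ∀ t → t + suc t + (suc t + suc t) ≡ suc (4 * t + 2)
    pendant-many = solve-∀
    many-pendant : ∀ t → suc t + suc t + (t + suc t) ≡ suc (4 * t + 2)
    many-pendant = solve-∀
    many-many : ∀ t → suc t + suc t + (suc t + suc t) ≡ suc (suc (4 * t + 2))
    many-many = solve-∀

  -- t (suc (suc m)) = 4 t (suc m) + 2: each child block pair needs 2 t (suc m) + 1 black vertices
  -- unless it yields a fort, and if both just do, x is white or the count is exceeded.
  internal-outcome : ∀ {m x c₁ c₂ c} → Internal x → Internal (left x) → Internal (right x) →
    black# x + (c₁ + c₂) ≤ c → ChildOutcome m (left x) c₁ → ChildOutcome m (right x) c₂ → Outcome (suc m) x c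
  internal-outcome _ _ _ _ (inj₁ F) _ = inj₁ F
  internal-outcome _ _ _ _ (inj₂ _) (inj₁ F) = inj₁ F
  internal-outcome {m} {x} {c = c} x-int l-int r-int count≤
    (inj₂ (inj₁ ((g₁ , l-g₁ , P₁) , b₁))) (inj₂ (inj₁ ((g₂ , r-g₂ , P₂) , b₂))) with black x in black-x
  ... | false = inj₂ (inj₁ (grandchildren-pendant-fort x g₁ g₂ x-int l-int r-int black-x l-g₁ r-g₂ P₁ P₂ ,
                           subst (_≤ c) (pendant-pair (t (suc m))) (sum≤ 0 b₁ b₂ count≤)))
  ... | true = inj₂ (inj₂ (subst (λ z → suc z ≤ c) (pendant-pair (t (suc m))) (≤-trans (s≤s (+-mono-≤ b₁ b₂)) count≤)))
  internal-outcome {m} {x} {c = c} _ _ _ count≤ (inj₂ (inj₁ (_ , b₁))) (inj₂ (inj₂ b₂)) =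
    inj₂ (inj₂ (subst (_≤ c) (pendant-many (t (suc m))) (sum≤ (black# x) b₁ b₂ count≤)))
  internal-outcome {m} {x} {c = c} _ _ _ count≤ (inj₂ (inj₂ b₁)) (inj₂ (inj₁ (_ , b₂))) =
    inj₂ (inj₂ (subst (_≤ c) (many-pendant (t (suc m))) (sum≤ (black# x) b₁ b₂ count≤)))
  internal-outcome {m} {x} {c = c} _ _ _ count≤ (inj₂ (inj₂ b₁)) (inj₂ (inj₂ b₂)) =
    inj₂ (inj₂ (≤-trans (n≤1+n _) (subst (_≤ c) (many-many (t (suc m))) (sum≤ (black# x) b₁ b₂ count≤))))

  block-outcome : ∀ m x j → Block m x j → Outcome m x (blockCount m x j)
  block-outcome zero _ j (refl , j<L) =
    subst (Outcome 0 (firstLeaf + j)) (sym (cong (black# (firstLeaf + j) +_) (count-gadget j)))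
      (leaf-outcome j j<L _ _ _ _ _ refl refl refl refl refl)
  block-outcome (suc m) x j block@(B₁ , B₂ , B₃ , B₄) =
    internal-outcome {m} {x} x-int l-int r-int count≤
      (child-outcome {m} {left x} l-int (block-outcome m (ll x) j B₁) (block-outcome m (lr x) (j + 4 ^ m) B₂))
      (child-outcome {m} {right x} r-int
        (block-outcome m (rl x) (j + 2 * 4 ^ m) B₃) (block-outcome m (rr x) (j + 3 * 4 ^ m) B₄))
    where
    x-int = proj₁ (block-internal m x j block)
    l-int = proj₁ (proj₂ (block-internal m x j block))
    r-int = proj₂ (proj₂ (block-internal m x j block))
    count≤ : black# x + (blockCount m (ll x) j + blockCount m (lr x) (j + 4 ^ m)
                        + (blockCount m (rl x) (j + 2 * 4 ^ m) + blockCount m (rr x) (j + 3 * 4 ^ m)))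
             ≤ blockCount (suc m) x j
    count≤ = ≤-trans (m≤m+n _ (black# (left x) + black# (right x)))
               (≤-reflexive (eq₁ (black# x) (black# (left x)) (black# (right x)) _ _ _ _))
      where
      eq₁ : ∀ a b c d e f g → a + (d + e + (f + g)) + (b + c) ≡ a + b + c + d + e + f + g
      eq₁ = solve-∀

ℕGraph : ℕ → (ℕ → ℕ → Set) → Graph
ℕGraph k R = record { V = k ; Adj = λ x y → R (toℕ x) (toℕ y) }

module _ {k : ℕ} (R : ℕ → ℕ → Set) (S : Subset k) where

  ℕfort⇒¬zeroForcing : (F : ℕ → Set) → (∀ y → F y → y < k) → (∀ y → F y → memberℕ S y ≡ false) →
    (∀ v u → ¬ F v → F u → R v u → Σ ℕ λ w → w ≢ u × R v w × F w) → Σ ℕ F →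
    ¬ IsZeroForcingSet (ℕGraph k R) S
  ℕfort⇒¬zeroForcing F bound white closed (y , Fy) =
    fort⇒¬zeroForcing (ℕGraph k R) {F = λ v → F (toℕ v)} fort
      (λ v Fv → memberℕ-false⇒∉ S v (white (toℕ v) Fv)) (fromℕ< (bound y Fy) , subst F (sym (toℕ-fromℕ< _)) Fy)
    where
    fort : IsFort (ℕGraph k R) (λ v → F (toℕ v))
    fort v u ¬Fv Fu vu with closed (toℕ v) (toℕ u) ¬Fv Fu vu
    ... | w , w≢u , vw , Fw =
      fromℕ< (bound w Fw) , (λ w≡u → w≢u (trans (sym (toℕ-fromℕ< _)) (cong toℕ w≡u))) ,
      subst (R (toℕ v)) (sym (toℕ-fromℕ< _)) vw , subst F (sym (toℕ-fromℕ< _)) Fw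

module LowerBound (m0 : ℕ) where
  open Heap m0

  private
    t<c⇒t+1≤c : ∀ {c} → t n < c → t n + 1 ≤ c
    t<c⇒t+1≤c {c} = subst (_≤ c) (+-comm 1 (t n))

  module _ (S : Subset order) where
    open Forts m0 S
    open BlockCount m0 S

    lower-bound-G : IsZeroForcingSet (G n) S → t n + 1 ≤ ∣ S ∣
    lower-bound-G zfs with block-outcome m0 0 0 block-root
    ... | inj₁ (fort F y∈F bounds white closed) =
      ⊥-elim (ℕfort⇒¬zeroForcing Adjℕ S F (λ y y∈F → proj₂ (bounds y y∈F)) white closed y∈F zfs)
    ... | inj₂ (inj₁ (pendantFort F 0∈F bounds white closed , _)) =
      ⊥-elim (ℕfort⇒¬zeroForcing Adjℕ S F (λ y y∈F → proj₂ (bounds y y∈F)) white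
                (λ v u v∉F u∈F vu → closed v u v∉F (¬Parent-root {v}) u∈F vu) (0 , 0∈F) zfs)
    ... | inj₂ (inj₂ t<c) = t<c⇒t+1≤c (subst (t n <_) (trans blockCount-root (countFrom-all S)) t<c)

  module _ (S : Subset (suc order)) where
    open Forts m0 S
    open BlockCount m0 S

    private
      count-Ĝ : blockCount m0 0 0 + black# order ≡ ∣ S ∣
      count-Ĝ = begin
        blockCount m0 0 0 + black# order     ≡⟨ cong₂ _+_ blockCount-root (sym (+-identityʳ (black# order))) ⟩
        count 0 order + count order 1        ≡⟨ sym (countFrom-+ S 0 order 1) ⟩
        count 0 (order + 1)                  ≡⟨ cong (count 0) (+-comm order 1) ⟩
        count 0 (suc order)                  ≡⟨ countFrom-all S ⟩
        ∣ S ∣                                ∎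
        where open ≡-Reasoning

      fort-Ĝ : Fort → ¬ IsZeroForcingSet (Ĝ n) S
      fort-Ĝ (fort F y∈F bounds white closed) =
        ℕfort⇒¬zeroForcing AdjĜ S F (λ y y∈F → ≤-trans (proj₂ (bounds y y∈F)) (n≤1+n order)) white closedĜ y∈F
        where
        closedĜ : ∀ v u → ¬ F v → F u → AdjĜ v u → Σ ℕ λ w → w ≢ u × AdjĜ v w × F w
        closedĜ v u v∉F u∈F vu with AdjĜ-cases vu
        ... | inj₁ vu′ with closed v u v∉F u∈F vu′
        ...   | w , w≢u , vw , w∈F = w , w≢u , Adjℕ⇒AdjĜ vw , w∈F
        closedĜ v u v∉F u∈F vu | inj₂ (inj₁ (_ , refl)) = ⊥-elim (<-irrefl refl (proj₂ (bounds u u∈F)))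
        closedĜ v u v∉F u∈F vu | inj₂ (inj₂ (_ , refl)) with () ← proj₁ (bounds u u∈F)

      -- A pendant fort at the root together with a white y_n is a fort of Ĝ_n.
      pendant-fort-Ĝ : PendantFort 0 → black order ≡ false → ¬ IsZeroForcingSet (Ĝ n) S
      pendant-fort-Ĝ (pendantFort F 0∈F bounds white closed) white-y =
        ℕfort⇒¬zeroForcing AdjĜ S F′ bound′ white′ closed′ (0 , inj₁ 0∈F)
        where
        F′ : ℕ → Set
        F′ y = F y ⊎ y ≡ order
        bound′ : ∀ y → F′ y → y < suc order
        bound′ y (inj₁ y∈F) = ≤-trans (proj₂ (bounds y y∈F)) (n≤1+n order)
        bound′ y (inj₂ refl) = ≤-refl
        white′ : ∀ y → F′ y → black y ≡ false
        white′ y (inj₁ y∈F) = white y y∈F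
        white′ y (inj₂ refl) = white-y
        closed′ : ∀ v u → ¬ F′ v → F′ u → AdjĜ v u → Σ ℕ λ w → w ≢ u × AdjĜ v w × F′ w
        closed′ v u v∉F′ (inj₁ u∈F) vu with AdjĜ-cases vu
        ... | inj₁ vu′ with closed v u (λ v∈F → v∉F′ (inj₁ v∈F)) (¬Parent-root {v}) u∈F vu′
        ...   | w , w≢u , vw , w∈F = w , w≢u , Adjℕ⇒AdjĜ vw , inj₁ w∈F
        closed′ v u v∉F′ (inj₁ u∈F) vu | inj₂ (inj₁ (_ , refl)) = ⊥-elim (<-irrefl refl (proj₂ (bounds u u∈F)))
        closed′ v u v∉F′ (inj₁ u∈F) vu | inj₂ (inj₂ (refl , _)) = ⊥-elim (v∉F′ (inj₂ refl))
        closed′ v u v∉F′ (inj₂ refl) vu with AdjĜ-cases vu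
        ... | inj₁ vu′ = ⊥-elim (<-irrefl refl (Adjℕ<order vu′))
        ... | inj₂ (inj₁ (refl , _)) = ⊥-elim (v∉F′ (inj₁ 0∈F))
        ... | inj₂ (inj₂ (refl , _)) = ⊥-elim (v∉F′ (inj₂ refl))

    lower-bound-Ĝ : IsZeroForcingSet (Ĝ n) S → t n + 1 ≤ ∣ S ∣
    lower-bound-Ĝ zfs with block-outcome m0 0 0 block-root
    ... | inj₁ F = ⊥-elim (fort-Ĝ F zfs)
    ... | inj₂ (inj₁ (P , t≤c)) with black order in black-y
    ...   | false = ⊥-elim (pendant-fort-Ĝ P black-y zfs)
    ...   | true = subst (t n + 1 ≤_) count-Ĝ (+-mono-≤ t≤c (≤-reflexive (sym (cong indicator black-y))))
    lower-bound-Ĝ zfs | inj₂ (inj₂ t<c) = t<c⇒t+1≤c (≤-trans t<c (≤-trans (m≤m+n _ _) (≤-reflexive count-Ĝ)))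

module UpperBound (m0 : ℕ) where
  open Heap m0

  module Seed (k : ℕ) where
    single : ℕ → Subset k
    single y with y <? k
    ... | yes y<k = ⁅ fromℕ< y<k ⁆
    ... | no _ = ∅

    ∣single∣≤1 : ∀ y → ∣ single y ∣ ≤ 1
    ∣single∣≤1 y with y <? k
    ... | yes y<k = ≤-reflexive (∣⁅x⁆∣≡1 (fromℕ< y<k))
    ... | no _ = ≤-trans (≤-reflexive (∣⊥∣≡0 k)) z≤n

    single-member : ∀ y → y < k → Σ (Fin k) λ v → toℕ v ≡ y × v ∈ single y
    single-member y y<k with y <? k
    ... | yes y<k′ = fromℕ< y<k′ , toℕ-fromℕ< y<k′ , x∈⁅x⁆ (fromℕ< y<k′)
    ... | no y≮k = ⊥-elim (y≮k y<k)

    blockSeed : ℕ → ℕ → ℕ → Subset k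
    blockSeed zero x j = single (gad-a j) ∪ single (gad-c j)
    blockSeed (suc m) x j = single (ll x) ∪ single (rl x) ∪ blockSeed m (ll x) j ∪ blockSeed m (lr x) (j + 4 ^ m)
                            ∪ blockSeed m (rl x) (j + 2 * 4 ^ m) ∪ blockSeed m (rr x) (j + 3 * 4 ^ m)

    ∣blockSeed∣≤t : ∀ m x j → ∣ blockSeed m x j ∣ ≤ t (suc m)
    ∣blockSeed∣≤t zero x j =
      ≤-trans (∣p∪q∣≤∣p∣+∣q∣ (single (gad-a j)) (single (gad-c j))) (+-mono-≤ (∣single∣≤1 (gad-a j)) (∣single∣≤1 (gad-c j)))
    ∣blockSeed∣≤t (suc m) x j =
      ≤-trans (∣p∪q∣≤∣p∣+∣q∣ (single (ll x)) _) (≤-trans (+-mono-≤ (∣single∣≤1 (ll x))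
      (≤-trans (∣p∪q∣≤∣p∣+∣q∣ (single (rl x)) _) (+-mono-≤ (∣single∣≤1 (rl x))
      (≤-trans (∣p∪q∣≤∣p∣+∣q∣ D₁ _) (+-mono-≤ (∣blockSeed∣≤t m (ll x) j)
      (≤-trans (∣p∪q∣≤∣p∣+∣q∣ D₂ _) (+-mono-≤ (∣blockSeed∣≤t m (lr x) _)
      (≤-trans (∣p∪q∣≤∣p∣+∣q∣ D₃ D₄) (+-mono-≤ (∣blockSeed∣≤t m (rl x) _) (∣blockSeed∣≤t m (rr x) _))))))))))
      (≤-reflexive (eq₁ (t (suc m)))))
      where
      eq₁ : ∀ q → 1 + (1 + (q + (q + (q + q)))) ≡ 4 * q + 2
      eq₁ = solve-∀
      D₁ = blockSeed m (ll x) j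
      D₂ = blockSeed m (lr x) (j + 4 ^ m)
      D₃ = blockSeed m (rl x) (j + 2 * 4 ^ m)
      D₄ = blockSeed m (rr x) (j + 3 * 4 ^ m)

    seed : Subset k
    seed = single 0 ∪ blockSeed m0 0 0

    ∣seed∣≤t+1 : ∣ seed ∣ ≤ t n + 1
    ∣seed∣≤t+1 = ≤-trans (∣p∪q∣≤∣p∣+∣q∣ (single 0) (blockSeed m0 0 0))
      (≤-trans (+-mono-≤ (∣single∣≤1 0) (∣blockSeed∣≤t m0 0 0)) (≤-reflexive (+-comm 1 (t n))))

  -- Forcing from the seed in any graph that contains G_n and agrees with it at the non-root vertices of G_n.
  module Forcing (k : ℕ) (R : ℕ → ℕ → Set) (order≤k : order ≤ k)
    (Adjℕ⇒R : ∀ {a b} → Adjℕ a b → R a b) (R⇒Adjℕ : ∀ {a b} → a ≢ 0 → a < order → R a b → Adjℕ a b) where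
    open Seed k

    Γ : Graph
    Γ = ℕGraph k R

    Seeded : ℕ → Set
    Seeded y = Σ (Fin k) λ v → toℕ v ≡ y × v ∈ seed

    ForcedAt : (ℕ → Set) → Set
    ForcedAt P = Forced Γ seed (λ v → P (toℕ v))

    forcedAt-mono : ∀ {P Q} → ForcedAt P → (∀ y → Q y → P y) → ForcedAt Q
    forcedAt-mono forced Q⊆P = forced-mono Γ forced (λ v → Q⊆P (toℕ v))

    forcedAt-∪-seed : ∀ {P} → ForcedAt P → ForcedAt (λ y → P y ⊎ Seeded y)
    forcedAt-∪-seed {P} forced = forced-mono Γ (forced-∪-initial Γ forced) from-seed
      where
      from-seed : ∀ v → P (toℕ v) ⊎ Seeded (toℕ v) → P (toℕ v) ⊎ v ∈ seed
      from-seed v (inj₁ Pv) = inj₁ Pv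
      from-seed v (inj₂ (v′ , v′≡v , v′∈seed)) = inj₂ (subst (_∈ seed) (toℕ-injective v′≡v) v′∈seed)

    forcedAt-force : ∀ {P} → ForcedAt P → ∀ v u → v ≢ 0 → P v → (∀ w → Adjℕ v w → w ≢ u → P w) → Adjℕ v u →
                     ForcedAt (λ y → P y ⊎ y ≡ u)
    forcedAt-force {P} forced v u v≢0 Pv others vu = forced-mono Γ forced′ back
      where
      v<k = ≤-trans (Adjℕ<order (Adjℕ-sym vu)) order≤k
      u<k = ≤-trans (Adjℕ<order vu) order≤k
      vF = fromℕ< v<k
      uF = fromℕ< u<k
      others′ : ∀ w → Adj Γ vF w → w ≢ uF → P (toℕ w)
      others′ w vw w≢u =
        others (toℕ w) (R⇒Adjℕ v≢0 (Adjℕ<order (Adjℕ-sym vu)) (subst (λ z → R z (toℕ w)) (toℕ-fromℕ< v<k) vw))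
          (λ w≡u → w≢u (toℕ-injective (trans w≡u (sym (toℕ-fromℕ< u<k)))))
      forced′ = forced-force Γ forced vF uF (subst P (sym (toℕ-fromℕ< v<k)) Pv) others′
                  (subst₂ R (sym (toℕ-fromℕ< v<k)) (sym (toℕ-fromℕ< u<k)) (Adjℕ⇒R vu))
      back : ∀ x → P (toℕ x) ⊎ toℕ x ≡ u → P (toℕ x) ⊎ x ≡ uF
      back x (inj₁ Px) = inj₁ Px
      back x (inj₂ x≡u) = inj₂ (toℕ-injective (trans x≡u (sym (toℕ-fromℕ< u<k))))

    seeded : ∀ y → y < order → (∀ v → v ∈ single y → v ∈ seed) → Seeded y
    seeded y y<o single⊆seed with single-member y (≤-trans y<o order≤k)
    ... | v , v≡y , v∈single = v , v≡y , single⊆seed v v∈single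

    private
      gadget≢0 : ∀ {y} → T ≤ y → y ≢ 0
      gadget≢0 T≤y refl with () ← ≤-trans 1≤T T≤y

    -- In a leaf block with ℓ black and a, c seeded: a → e (its neighbours ℓ, c are black), then c → b.
    leaf-forced : ∀ j → j < L → (∀ v → v ∈ blockSeed 0 (firstLeaf + j) j → v ∈ seed) →
                  (P : ℕ → Set) → ForcedAt P → P (firstLeaf + j) → ForcedAt (λ y → P y ⊎ InBlock 0 (firstLeaf + j) j y)
    leaf-forced j j<L seeds P forced P-leaf = forcedAt-mono after-c done
      where
      Q : ℕ → Set
      Q y = P y ⊎ Seeded y
      a-seeded : Seeded (gad-a j)
      a-seeded = seeded (gad-a j) (gad-a<order j<L) (λ v v∈ → seeds v (x∈p∪q⁺ (inj₁ v∈)))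
      c-seeded : Seeded (gad-c j)
      c-seeded = seeded (gad-c j) (gad-c<order j<L) (λ v v∈ → seeds v (x∈p∪q⁺ (inj₂ v∈)))
      a-others : ∀ w → Adjℕ (gad-a j) w → w ≢ gad-e j → Q w
      a-others w aw w≢e with nbrs-a {j = j} refl (Adjℕ-sym aw)
      ... | inj₁ refl = inj₁ P-leaf
      ... | inj₂ (inj₁ refl) = inj₂ c-seeded
      ... | inj₂ (inj₂ refl) = ⊥-elim (w≢e refl)
      after-a : ForcedAt (λ y → Q y ⊎ y ≡ gad-e j)
      after-a = forcedAt-force (forcedAt-∪-seed {P} forced) (gad-a j) (gad-e j) (gadget≢0 (T≤gad-a j))
                  (inj₂ a-seeded) a-others (inj₁ (a-e j j<L))
      c-others : ∀ w → Adjℕ (gad-c j) w → w ≢ gad-b j → Q w ⊎ w ≡ gad-e j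
      c-others w cw w≢b with nbrs-c {j = j} refl (Adjℕ-sym cw)
      ... | inj₁ refl = inj₁ (inj₂ a-seeded)
      ... | inj₂ (inj₁ refl) = ⊥-elim (w≢b refl)
      ... | inj₂ (inj₂ refl) = inj₂ refl
      after-c : ForcedAt (λ y → (Q y ⊎ y ≡ gad-e j) ⊎ y ≡ gad-b j)
      after-c = forcedAt-force after-a (gad-c j) (gad-b j) (gadget≢0 (T≤gad-c j))
                  (inj₁ (inj₂ c-seeded)) c-others (inj₂ (b-c j j<L))
      done : ∀ y → P y ⊎ InBlock 0 (firstLeaf + j) j y → (Q y ⊎ y ≡ gad-e j) ⊎ y ≡ gad-b j
      done y (inj₁ Py) = inj₁ (inj₁ (inj₁ Py))
      done _ (inj₂ (inj₁ refl)) = inj₁ (inj₁ (inj₁ P-leaf))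
      done _ (inj₂ (inj₂ (inj₁ refl))) = inj₁ (inj₁ (inj₂ a-seeded))
      done _ (inj₂ (inj₂ (inj₂ (inj₁ refl)))) = inj₂ refl
      done _ (inj₂ (inj₂ (inj₂ (inj₂ (inj₁ refl))))) = inj₁ (inj₁ (inj₂ c-seeded))
      done _ (inj₂ (inj₂ (inj₂ (inj₂ (inj₂ refl))))) = inj₁ (inj₂ refl)

    block-forced : ∀ m x j → Block m x j → (∀ v → v ∈ blockSeed m x j → v ∈ seed) →
                   (P : ℕ → Set) → ForcedAt P → P x → ForcedAt (λ y → P y ⊎ InBlock m x j y)

    -- Below a black x, for a child c of x with left c seeded: the block of left c, then left c → c,
    -- c → right c (the other neighbours of c are x and left c), and the block of right c.
    child-forced : ∀ m x c j₁ j₂ → Parent x c → Internal c → Block m (left c) j₁ → Block m (right c) j₂ →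
      Seeded (left c) → (∀ v → v ∈ blockSeed m (left c) j₁ → v ∈ seed) → (∀ v → v ∈ blockSeed m (right c) j₂ → v ∈ seed) →
      (P : ℕ → Set) → ForcedAt P → P x →
      ForcedAt (λ y → P y ⊎ y ≡ c ⊎ InBlock m (left c) j₁ y ⊎ InBlock m (right c) j₂ y)
    child-forced m x c j₁ j₂ x-c c-int B₁ B₂ lc-seeded seeds₁ seeds₂ P forced Px = forcedAt-mono after-right done
      where
      Q₀ Q₁ Q₂ Q₃ : ℕ → Set
      Q₀ y = P y ⊎ Seeded y
      Q₁ y = Q₀ y ⊎ InBlock m (left c) j₁ y
      Q₂ y = Q₁ y ⊎ y ≡ c
      Q₃ y = Q₂ y ⊎ y ≡ right c
      after-left : ForcedAt Q₁
      after-left = block-forced m (left c) j₁ B₁ seeds₁ Q₀ (forcedAt-∪-seed {P} forced) (inj₂ lc-seeded)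
      lc-others : ∀ w → Adjℕ (left c) w → w ≢ c → Q₁ w
      lc-others w lc-w w≢c with nbrs-block-root m (left c) j₁ B₁ (Adjℕ-sym lc-w)
      ... | inj₁ w∈B₁ = inj₂ w∈B₁
      ... | inj₂ w-lc = ⊥-elim (w≢c (Parent-unique {w} {c} w-lc (inj₁ refl)))
      after-c : ForcedAt Q₂
      after-c = forcedAt-force after-left (left c) c (λ lc≡0 → ¬Parent-root {c} (subst (Parent c) lc≡0 (inj₁ refl)))
                  (inj₂ (InBlock-root m (left c) j₁)) lc-others (inj₂ (tree-left c c-int))
      c-others : ∀ w → Adjℕ c w → w ≢ right c → Q₂ w
      c-others w c-w w≢rc with nbrs-internal c-int (Adjℕ-sym c-w)
      ... | inj₁ refl = inj₁ (inj₂ (InBlock-root m (left c) j₁))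
      ... | inj₂ (inj₁ refl) = ⊥-elim (w≢rc refl)
      ... | inj₂ (inj₂ w-c) with refl ← Parent-unique {w} {x} w-c x-c = inj₁ (inj₁ (inj₁ Px))
      after-rc : ForcedAt Q₃
      after-rc = forcedAt-force after-c c (right c) (λ c≡0 → ¬Parent-root {x} (subst (Parent x) c≡0 x-c))
                   (inj₂ refl) c-others (inj₁ (tree-right c c-int))
      after-right : ForcedAt (λ y → Q₃ y ⊎ InBlock m (right c) j₂ y)
      after-right = block-forced m (right c) j₂ B₂ seeds₂ Q₃ after-rc (inj₂ refl)
      done : ∀ y → P y ⊎ y ≡ c ⊎ InBlock m (left c) j₁ y ⊎ InBlock m (right c) j₂ y → Q₃ y ⊎ InBlock m (right c) j₂ y
      done y (inj₁ Py) = inj₁ (inj₁ (inj₁ (inj₁ (inj₁ Py))))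
      done y (inj₂ (inj₁ y≡c)) = inj₁ (inj₁ (inj₂ y≡c))
      done y (inj₂ (inj₂ (inj₁ y∈B₁))) = inj₁ (inj₁ (inj₁ (inj₂ y∈B₁)))
      done y (inj₂ (inj₂ (inj₂ y∈B₂))) = inj₂ y∈B₂

    block-forced zero _ j (refl , j<L) = leaf-forced j j<L
    block-forced (suc m) x j block@(B₁ , B₂ , B₃ , B₄) seeds P forced Px = forcedAt-mono after-right done
      where
      l-int = proj₁ (proj₂ (block-internal m x j block))
      r-int = proj₂ (proj₂ (block-internal m x j block))
      ll-seeded : Seeded (ll x)
      ll-seeded = seeded (ll x) (tree<order (block<T m (ll x) j B₁)) (λ v v∈ → seeds v (x∈p∪q⁺ (inj₁ v∈)))
      rl-seeded : Seeded (rl x)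
      rl-seeded = seeded (rl x) (tree<order (block<T m (rl x) _ B₃))
                    (λ v v∈ → seeds v (x∈p∪q⁺ (inj₂ (x∈p∪q⁺ (inj₁ v∈)))))
      seeds-of : ∀ {D} → (∀ {v} → v ∈ D → v ∈ blockSeed (suc m) x j) → ∀ v → v ∈ D → v ∈ seed
      seeds-of D⊆ v v∈D = seeds v (D⊆ v∈D)
      P′ P″ : ℕ → Set
      P′ y = P y ⊎ y ≡ left x ⊎ InBlock m (ll x) j y ⊎ InBlock m (lr x) (j + 4 ^ m) y
      P″ y = P′ y ⊎ y ≡ right x ⊎ InBlock m (rl x) (j + 2 * 4 ^ m) y ⊎ InBlock m (rr x) (j + 3 * 4 ^ m) y
      after-left : ForcedAt P′
      after-left = child-forced m x (left x) j (j + 4 ^ m) (inj₁ refl) l-int B₁ B₂ ll-seeded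
        (seeds-of (λ v∈ → x∈p∪q⁺ (inj₂ (x∈p∪q⁺ (inj₂ (x∈p∪q⁺ (inj₁ v∈)))))))
        (seeds-of (λ v∈ → x∈p∪q⁺ (inj₂ (x∈p∪q⁺ (inj₂ (x∈p∪q⁺ (inj₂ (x∈p∪q⁺ (inj₁ v∈))))))))) P forced Px
      after-right : ForcedAt P″
      after-right = child-forced m x (right x) (j + 2 * 4 ^ m) (j + 3 * 4 ^ m) (inj₂ refl) r-int B₃ B₄ rl-seeded
        (seeds-of (λ v∈ → x∈p∪q⁺ (inj₂ (x∈p∪q⁺ (inj₂ (x∈p∪q⁺ (inj₂ (x∈p∪q⁺ (inj₂ (x∈p∪q⁺ (inj₁ v∈)))))))))))
        (seeds-of (λ v∈ → x∈p∪q⁺ (inj₂ (x∈p∪q⁺ (inj₂ (x∈p∪q⁺ (inj₂ (x∈p∪q⁺ (inj₂ (x∈p∪q⁺ (inj₂ v∈)))))))))))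
        P′ after-left (inj₁ Px)
      done : ∀ y → P y ⊎ InBlock (suc m) x j y → P″ y
      done y (inj₁ Py) = inj₁ (inj₁ Py)
      done y (inj₂ (inj₁ refl)) = inj₁ (inj₁ Px)
      done y (inj₂ (inj₂ (inj₁ y≡l))) = inj₁ (inj₂ (inj₁ y≡l))
      done y (inj₂ (inj₂ (inj₂ (inj₁ y≡r)))) = inj₂ (inj₁ y≡r)
      done y (inj₂ (inj₂ (inj₂ (inj₂ (inj₁ y∈B₁))))) = inj₁ (inj₂ (inj₂ (inj₁ y∈B₁)))
      done y (inj₂ (inj₂ (inj₂ (inj₂ (inj₂ (inj₁ y∈B₂)))))) = inj₁ (inj₂ (inj₂ (inj₂ y∈B₂)))
      done y (inj₂ (inj₂ (inj₂ (inj₂ (inj₂ (inj₂ (inj₁ y∈B₃))))))) = inj₂ (inj₂ (inj₁ y∈B₃))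
      done y (inj₂ (inj₂ (inj₂ (inj₂ (inj₂ (inj₂ (inj₂ y∈B₄))))))) = inj₂ (inj₂ (inj₂ y∈B₄))

    seed-forces-tree : ForcedAt (λ y → Seeded y ⊎ InBlock m0 0 0 y)
    seed-forces-tree =
      block-forced m0 0 0 block-root (λ v v∈ → x∈p∪q⁺ (inj₂ v∈)) Seeded
        (forced-mono Γ (forced-initial Γ seed) (λ { v (v′ , v′≡v , v′∈seed) → subst (_∈ seed) (toℕ-injective v′≡v) v′∈seed }))
        (seeded 0 (tree<order 1≤T) (λ v v∈ → x∈p∪q⁺ (inj₁ v∈)))

  open Seed using (seed; ∣seed∣≤t+1) public

  zeroForcing-G : IsZeroForcingSet (G n) (seed order)
  zeroForcing-G = forced-all⇒zeroForcing (G n) seed-forces-tree (λ v → inj₂ (InBlock-everything m0 (toℕ v) (toℕ<n v)))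
    where open Forcing order Adjℕ ≤-refl (λ vw → vw) (λ _ _ vw → vw)

  -- In Ĝ_n the root finally forces y_n, its only neighbour outside the tree.
  zeroForcing-Ĝ : IsZeroForcingSet (Ĝ n) (seed (suc order))
  zeroForcing-Ĝ = forced-all⇒zeroForcing (Ĝ n)
    (forced-force (Ĝ n) seed-forces-tree Fin.zero y (inj₂ (InBlock-root m0 0 0)) root-others root-y′) everything
    where
    AdjĜ⇒Adjℕ : ∀ {a b} → a ≢ 0 → a < order → AdjĜ a b → Adjℕ a b
    AdjĜ⇒Adjℕ a≢0 a<o ab with AdjĜ-cases ab
    ... | inj₁ ab′ = ab′
    ... | inj₂ (inj₁ (a≡0 , _)) = ⊥-elim (a≢0 a≡0)
    ... | inj₂ (inj₂ (refl , _)) = ⊥-elim (<-irrefl refl a<o)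
    open Forcing (suc order) AdjĜ (n≤1+n order) Adjℕ⇒AdjĜ AdjĜ⇒Adjℕ
    y : Fin (suc order)
    y = Data.Fin.fromℕ order
    root-y′ : Adj (Ĝ n) Fin.zero y
    root-y′ = inj₁ (subst (GHatEdge n 0) (sym (toℕ-fromℕ order)) root-y)
    root-others : ∀ w → Adj (Ĝ n) Fin.zero w → w ≢ y → Seeded (toℕ w) ⊎ InBlock m0 0 0 (toℕ w)
    root-others w 0-w w≢y with AdjĜ-cases 0-w
    ... | inj₁ 0-w′ with nbrs-block-root m0 0 0 block-root (Adjℕ-sym 0-w′)
    ...   | inj₁ w∈B = inj₂ w∈B
    ...   | inj₂ w-0 = ⊥-elim (¬Parent-root {toℕ w} w-0)
    root-others w 0-w w≢y | inj₂ (inj₁ (_ , w≡order)) = ⊥-elim (w≢y (toℕ-injective (trans w≡order (sym (toℕ-fromℕ order)))))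
    root-others w 0-w w≢y | inj₂ (inj₂ (0≡order , _)) = ⊥-elim (<⇒≢ (tree<order 1≤T) 0≡order)
    everything : ∀ v → (Seeded (toℕ v) ⊎ InBlock m0 0 0 (toℕ v)) ⊎ v ≡ y
    everything v with toℕ v <? order
    ... | yes v<o = inj₁ (inj₂ (InBlock-everything m0 (toℕ v) v<o))
    ... | no v≮o = inj₂ (toℕ-injective (trans (≤-antisym (s≤s⁻¹ (toℕ<n v)) (≮⇒≥ v≮o)) (sym (toℕ-fromℕ order))))

proposition1 : (n : ℕ) → 1 ≤ n →
    ZeroForcingNumber (G n) (t n + 1) × ZeroForcingNumber (Ĝ n) (t n + 1)
proposition1 (suc m0) _ =
  zeroForcingNumber-intro (seed order) zeroForcing-G (∣seed∣≤t+1 order) lower-bound-G ,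
  zeroForcingNumber-intro (seed (suc order)) zeroForcing-Ĝ (∣seed∣≤t+1 (suc order)) lower-bound-Ĝ
  where
  open Heap m0 using (order)
  open LowerBound m0
  open UpperBound m0
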